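{- For disjoint $S,T$ with $S\sqcup T=I$, $S,T\neq\emptyset$, and compositions $F\in\Sigma[S]$, $G\in\Sigma[T]$, $K\in\Sigma[I]$, \[ \mu_{S,T}(\mathtt{C}_F\otimes \mathtt{C}_G)=\sum_{H\preceq (F|G)}(-1)^{l(F|G)-l(H)}\,\mathtt{C}_H \qquad\text{and}\qquad \Delta_{S,T}(\mathtt{C}_K)=\mathtt{C}_{K\text{ at }S}\otimes \mathtt{C}_{K\text{ at }T}, \] where $\mathtt{C}_{K\text{ at }S}:=\mathtt{C}_{K|_S}$ and $\mathtt{C}_{K\text{ at }T}:=\mathtt{C}_{K|_T}$ if $S$ is a union of an initial segment of lumps of $K$, and both are $0$ otherwise.
   Context: Let $\mathbb{k}$ be a field of characteristic zero and $I$ a finite set. A (set) composition of $I$ is an ordered tuple $F=(S_1,\dots,S_k)$ of nonempty disjoint subsets (lumps) with union $I$; $l(F)=k$ is its number of lumps and $\Sigma[I]$ is the set of compositions of $I$. For $S\subseteq I$, $F|_S$ is the composition of $S$ obtained by intersecting lumps with $S$ and deleting empty ones. A composition $F$ is identified with the total preposet (reflexive transitive relation) $\{(i_1,i_2): \text{the lump of } i_1 \text{ is weakly left of the lump of } i_2\}$. For preposets $p,q$ on $I$ write $q\le p$ if $p\subseteq q$, let $p_>$ be the set of pairs $(i_1,i_2)\in p$ with $(i_2,i_1)\notin p$, and write $q\preceq p$ if $q\le p$ and $p_>\subseteq q_>$; $l(p)$ is the number of classes of the equivalence relation $\{(i_1,i_2)\in p:(i_2,i_1)\in p\}$. For $F\in\Sigma[S]$,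 $G\in\Sigma[T]$, $(F|G)$ denotes the preposet on $I$ that is the disjoint union of $F$ and $G$ (so $l(F|G)=l(F)+l(G)$, and the compositions $H\preceq(F|G)$ are exactly the quasishuffles of $F$ and $G$). Let $\mathbf{\Sigma}^*[I]$ be the space of $\mathbb{k}$-valued functions on $\Sigma[I]$, with monomial basis $\mathtt{M}_F(G)=\delta_{FG}$. It is a commutative Hopf algebra in cospecies with $\mu_{S,T}(\mathtt{M}_F\otimes\mathtt{M}_G)=\sum_{H\preceq(F|G)}\mathtt{M}_H$ (quasishuffling) and $\Delta_{S,T}(\mathtt{M}_K)=\mathtt{M}_{K|_S}\otimes\mathtt{M}_{K|_T}$ if $S$ is a union of an initial segment of lumps of $K$, and $0$ otherwise (deconcatenation). The cone basis is $\mathtt{C}_p:=\sum_{F\le p}\mathtt{M}_F$ for a preposet $p$; for a composition $F$, $\mathtt{C}_F$ is the sum of $\mathtt{M}_G$ over compositions $G$ obtained from $F$ by merging contiguous lumps. -}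

module Defs where

open import Level using (Level; suc; _⊔_)
open import Data.Bool using (Bool; true; false; _∧_; _∨_; not; if_then_else_)
open import Data.Nat as ℕ using (ℕ; zero; _≡ᵇ_; _≤ᵇ_)
open import Data.Fin using (Fin)
open import Data.Vec using (Vec; []; _∷_; lookup)
open import Data.Fin.Subset using (Subset)
open import Data.List as List using (List; []; _∷_; allFin; upTo; concatMap; filterᵇ; length; take; foldr; map)
open import Data.Bool.ListAction using (and; or; any; all)
open import Data.Maybe using (Maybe; just; nothing)
open import Data.Product using (Σ)
open import Relation.Nullary using (¬_)
open import Relation.Binary.PropositionalEquality using (_≡_)
open import Algebra.Bundles using (CommutativeRing)

ofℕ : ∀ {c ℓ} (R : CommutativeRing c ℓ) → ℕ → CommutativeRing.Carrier R
ofℕ R zero = CommutativeRing.0# R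
ofℕ R (ℕ.suc n) = CommutativeRing._+_ R (CommutativeRing.1# R) (ofℕ R n)

record Field₀ (c ℓ : Level) : Set (suc (c ⊔ ℓ)) where
  field
    commRing : CommutativeRing c ℓ
  open CommutativeRing commRing public
  field
    1≉0      : ¬ (1# ≈ 0#)
    inverse  : ∀ x → ¬ (x ≈ 0#) → Σ Carrier (λ y → x * y ≈ 1#)
    charZero : ∀ n → ofℕ commRing n ≈ 0# → n ≡ 0

-- Finite combinatorics.  The finite set I is Fin n; subsets are
-- Subset n = Vec Bool n (canonical, so ≡ is set equality).

_∈ᵇ_ : ∀ {n} → Fin n → Subset n → Bool
i ∈ᵇ S = lookup S i

nonemptyᵇ : ∀ {n} → Subset n → Bool
nonemptyᵇ {n} L = any (λ i → i ∈ᵇ L) (allFin n)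

allSubsets : ∀ n → List (Subset n)
allSubsets zero = [] ∷ []
allSubsets (ℕ.suc n) = concatMap (λ L → (true ∷ L) ∷ (false ∷ L) ∷ []) (allSubsets n)

listsOfLength : ∀ {a} {A : Set a} → ℕ → List A → List (List A)
listsOfLength zero xs = [] ∷ []
listsOfLength (ℕ.suc k) xs = concatMap (λ x → map (x ∷_) (listsOfLength k xs)) xs

count : ∀ {a} {A : Set a} → (A → Bool) → List A → ℕ
count p xs = length (filterᵇ p xs)

-- A candidate composition is a list of lumps (ordered left to right).
Comp : ℕ → Set
Comp n = List (Subset n)

isComp : ∀ {n} → Subset n → Comp n → Bool
isComp {n} S K =
  all nonemptyᵇ K ∧
  all (λ i → count (λ L → i ∈ᵇ L) K ≡ᵇ (if i ∈ᵇ S then 1 else 0)) (allFin n)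

-- Σ[S] as an explicit list: all lists of at most n subsets, filtered.
comps : ∀ {n} → Subset n → List (Comp n)
comps {n} S = filterᵇ (isComp S) (concatMap (λ k → listsOfLength k (allSubsets n)) (upTo (ℕ.suc n)))

l : ∀ {n} → Comp n → ℕ
l = length

-- Preposets on Fin n, as Boolean relations

Rel₂ : ℕ → Set
Rel₂ n = Fin n → Fin n → Bool

pos : ∀ {n} → Comp n → Fin n → Maybe ℕ
pos [] i = nothing
pos (L ∷ K) i = if i ∈ᵇ L then just 0 else Data.Maybe.map ℕ.suc (pos K i)
  where import Data.Maybe

rel : ∀ {n} → Comp n → Rel₂ n
rel K i j with pos K i | pos K j
... | just a | just b = a ≤ᵇ b
... | _      | _      = false

_∣∣_ : ∀ {n} → Comp n → Comp n → Rel₂ n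
(F ∣∣ G) i j = rel F i j ∨ rel G i j

_⇒ᵇ_ : Bool → Bool → Bool
a ⇒ᵇ b = not a ∨ b

_⊆ᵣ_ : ∀ {n} → Rel₂ n → Rel₂ n → Bool
_⊆ᵣ_ {n} p q = all (λ i → all (λ j → p i j ⇒ᵇ q i j) (allFin n)) (allFin n)

_≤ₚ_ : ∀ {n} → Rel₂ n → Rel₂ n → Bool
q ≤ₚ p = p ⊆ᵣ q

strict : ∀ {n} → Rel₂ n → Rel₂ n
strict p i j = p i j ∧ not (p j i)

_≼ₚ_ : ∀ {n} → Rel₂ n → Rel₂ n → Bool
q ≼ₚ p = (q ≤ₚ p) ∧ (strict p ⊆ᵣ strict q)

restrict : ∀ {n} → Comp n → Subset n → Comp n
restrict K S = filterᵇ nonemptyᵇ (map (Data.Fin.Subset._∩_ S) K)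
  where import Data.Fin.Subset

isInitial : ∀ {n} → Subset n → Comp n → Bool
isInitial {n} S K = any (λ m → all (λ i → (i ∈ᵇ S) ⇔ᵇ or (map (λ L → i ∈ᵇ L) (take m K))) (allFin n)) (upTo (ℕ.suc (length K)))
  where
    _⇔ᵇ_ : Bool → Bool → Bool
    a ⇔ᵇ b = (a ⇒ᵇ b) ∧ (b ⇒ᵇ a)

-- The Hopf algebra Σ* (pointwise, over a field of characteristic zero)

module Hopf {c ℓ} (𝕜 : Field₀ c ℓ) where
  open Field₀ 𝕜 public
  import Data.List.Properties as LP
  import Data.Vec.Properties as VP
  import Data.Bool.Properties as BP
  open import Relation.Nullary.Decidable using (⌊_⌋)
  open import Data.Fin.Subset using (⊤; ∁)

  -- elements of Σ*[S]: functions on compositions (only their values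
  -- on compositions of S matter); Σ*[S] ⊗ Σ*[T] ≅ functions on Σ[S] × Σ[T]
  Elt : ℕ → Set c
  Elt n = Comp n → Carrier

  Elt₂ : ℕ → Set c
  Elt₂ n = Comp n → Comp n → Carrier

  ind : Bool → Carrier
  ind b = if b then 1# else 0#

  zeroE : ∀ {n} → Elt n
  zeroE _ = 0#

  _⊗_ : ∀ {n} → Elt n → Elt n → Elt₂ n
  (a ⊗ b) F G = a F * b G

  ∑ : ∀ {a} {A : Set a} → List A → (A → Carrier) → Carrier
  ∑ xs f = foldr (λ y r → f y + r) 0# xs

  sgn : ℕ → Carrier
  sgn zero = 1#
  sgn (ℕ.suc m) = - sgn m

  _≟ᶜ_ : ∀ {n} → Comp n → Comp n → Bool
  F ≟ᶜ G = ⌊ LP.≡-dec (VP.≡-dec BP._≟_) F G ⌋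

  M : ∀ {n} → Comp n → Elt n
  M F G = ind (F ≟ᶜ G)

  -- cone basis C_p = Σ_{F ≤ p} M_F, i.e. C_p(G) = [G ≤ p]
  Cₚ : ∀ {n} → Rel₂ n → Elt n
  Cₚ p G = ind (rel G ≤ₚ p)

  C : ∀ {n} → Comp n → Elt n
  C F = Cₚ (rel F)

  -- product on monomials: μ_{S,T}(M_F ⊗ M_G) = Σ_{H ∈ Σ[I], H ≼ (F|G)} M_H
  μM : ∀ {n} → Comp n → Comp n → Elt n
  μM F G K = ∑ (comps ⊤) (λ H → ind (rel H ≼ₚ (F ∣∣ G)) * M H K)

  -- linear extension to Σ*[S] ⊗ Σ*[T] (T = ∁ S, I = ⊤)
  μ : ∀ {n} → Subset n → Elt₂ n → Elt n
  μ S φ K = ∑ (comps S) (λ F → ∑ (comps (∁ S)) (λ G → φ F G * μM F G K))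

  -- coproduct on monomials: Δ_{S,T}(M_K) = M_{K|S} ⊗ M_{K|T} if S is a
  -- union of an initial segment of lumps of K, and 0 otherwise
  ΔM : ∀ {n} → Subset n → Comp n → Elt₂ n
  ΔM S K = if isInitial S K then M (restrict K S) ⊗ M (restrict K (∁ S)) else zeroE ⊗ zeroE

  Δ : ∀ {n} → Subset n → Elt n → Elt₂ n
  Δ S φ F' G' = ∑ (comps ⊤) (λ K → φ K * ΔM S K F' G')

  CatS CatT : ∀ {n} → Subset n → Comp n → Elt n
  CatS S K = if isInitial S K then C (restrict K S) else zeroE
  CatT S K = if isInitial S K then C (restrict K (∁ S)) else zeroE

module Submission where

-- Both identities are checked pointwise.  Write X ≤ Y when rel Y ⊆ rel X (X
-- arises from Y by merging contiguous lumps), so that C_Y(X) = [X ≤ Y].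
-- Coproduct: in Δ(C_K)(F′,G′) the only contributing K₂ is the concatenation
-- F′G′, and F′G′ ≤ K iff S is initial in K, F′ ≤ K|S and G′ ≤ K|T.
-- Product at K: since K ≼ (F′|G′) iff K|S = F′ and K|T = G′, the left side is
-- [K|S ≤ F][K|T ≤ G].  On the right the terms are the H with K ≤ H, H|S = F,
-- H|T = G, weighted by (−1)^{l F + l G − l H}; a sign-reversing involution ι
-- (split the first lump meeting S and T, or merge a pure-T lump with a next
-- pure-S lump of the same block of K) has as only fixed point the merge of F
-- and G along K, a term exactly when K|S ≤ F and K|T ≤ G; 2 being invertible,
-- the sum is that indicator.

open import Defs
open import Data.Nat using (ℕ) renaming (_+_ to _+ℕ_; _∸_ to _∸ℕ_)
open import Data.Bool using (true)
open import Data.Product using (_×_; _,_)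
open import Data.Fin.Subset using (Subset; Nonempty; ∁; ⊤)
open import Relation.Binary.PropositionalEquality using (_≡_)

module Compositions where

  open import Data.Bool using (Bool; true; false; _∧_; _∨_; not; if_then_else_; T)
  import Data.Bool.Properties as BP
  open import Data.Nat using (ℕ; zero; suc; _≤_; _≡ᵇ_; _≤ᵇ_)
  import Data.Nat.Properties as NP
  open import Data.Fin using (Fin; zero; suc)
  open import Data.Vec using ([]; _∷_; lookup)
  import Data.Vec.Properties as VP
  open import Data.Fin.Subset using (Subset; _∩_; _∪_; _─_; ∁; ⊤)
  open import Data.List as List using (List; []; _∷_; allFin; filterᵇ)
  open import Data.Bool.ListAction using (any; all)
  open import Data.List.Membership.Propositional using (_∈_)
  open import Data.List.Membership.Propositional.Properties using (∈-allFin)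
  open import Data.List.Relation.Unary.Any using (here; there)
  open import Data.List.Relation.Unary.All as All using (All; []; _∷_)
  open import Data.Maybe using (Maybe; just; nothing; is-just)
  open import Data.Product using (∃; _×_; _,_)
  open import Data.Sum using (_⊎_; inj₁; inj₂)
  open import Data.Empty using (⊥-elim)
  open import Relation.Binary.PropositionalEquality using (_≡_; refl; sym; trans; cong; cong₂; subst; _≢_)
  open import Function using (_∘_)

  false≢true : false ≢ true
  false≢true ()

  ≢true⇒false : ∀ {b} → b ≢ true → b ≡ false
  ≢true⇒false {false} _ = refl
  ≢true⇒false {true} h = ⊥-elim (h refl)

  ∧T₁ : ∀ {a b} → a ∧ b ≡ true → a ≡ true
  ∧T₁ {true} _ = refl

  ∧T₂ : ∀ {a b} → a ∧ b ≡ true → b ≡ true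
  ∧T₂ {true} h = h

  ∧I : ∀ {a b} → a ≡ true → b ≡ true → a ∧ b ≡ true
  ∧I refl refl = refl

  ∨E : ∀ {a b} → a ∨ b ≡ true → a ≡ true ⊎ b ≡ true
  ∨E {true} _ = inj₁ refl
  ∨E {false} h = inj₂ h

  ∨I₁ : ∀ {a b} → a ≡ true → a ∨ b ≡ true
  ∨I₁ refl = refl

  ∨I₂ : ∀ {a b} → b ≡ true → a ∨ b ≡ true
  ∨I₂ {true} _ = refl
  ∨I₂ {false} h = h

  ∨-false₁ : ∀ a {b} → (a ∨ b) ≡ false → a ≡ false
  ∨-false₁ false _ = refl

  ∨-false₂ : ∀ a {b} → (a ∨ b) ≡ false → b ≡ false
  ∨-false₂ false e = e

  not-true : ∀ {b} → not b ≡ true → b ≡ false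
  not-true {false} _ = refl

  ⇔⇒≡ : ∀ {a b} → (a ≡ true → b ≡ true) → (b ≡ true → a ≡ true) → a ≡ b
  ⇔⇒≡ {true} f g = sym (f refl)
  ⇔⇒≡ {false} {true} f g = g refl
  ⇔⇒≡ {false} {false} f g = refl

  T⇒true : ∀ {b} → T b → b ≡ true
  T⇒true {true} _ = refl

  true⇒T : ∀ {b} → b ≡ true → T b
  true⇒T refl = _

  ≤⇒≤ᵇtrue : ∀ {x y} → x ≤ y → (x ≤ᵇ y) ≡ true
  ≤⇒≤ᵇtrue le = T⇒true (NP.≤⇒≤ᵇ le)

  ≤ᵇtrue⇒≤ : ∀ {x y} → (x ≤ᵇ y) ≡ true → x ≤ y
  ≤ᵇtrue⇒≤ {x} {y} e = NP.≤ᵇ⇒≤ x y (true⇒T e)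

  all⁻ : ∀ {a} {A : Set a} (p : A → Bool) xs → all p xs ≡ true → ∀ {x} → x ∈ xs → p x ≡ true
  all⁻ p (y ∷ xs) h (here refl) = ∧T₁ h
  all⁻ p (y ∷ xs) h (there m) = all⁻ p xs (∧T₂ {p y} h) m

  all⁺ : ∀ {a} {A : Set a} (p : A → Bool) xs → (∀ {x} → x ∈ xs → p x ≡ true) → all p xs ≡ true
  all⁺ p [] h = refl
  all⁺ p (y ∷ xs) h = ∧I (h (here refl)) (all⁺ p xs (h ∘ there))

  any⁻ : ∀ {a} {A : Set a} (p : A → Bool) xs → any p xs ≡ true → ∃ λ x → x ∈ xs × p x ≡ true
  any⁻ p (y ∷ xs) h with ∨E {p y} h
  ... | inj₁ e = y , here refl , e
  ... | inj₂ e with any⁻ p xs e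
  ... | x , m , e' = x , there m , e'

  any⁺ : ∀ {a} {A : Set a} (p : A → Bool) xs {x} → x ∈ xs → p x ≡ true → any p xs ≡ true
  any⁺ p (y ∷ xs) (here refl) e = ∨I₁ e
  any⁺ p (y ∷ xs) (there m) e = ∨I₂ {p y} (any⁺ p xs m e)

  all⁻-false : ∀ {a} {A : Set a} (p : A → Bool) xs → all p xs ≡ false → ∃ λ x → x ∈ xs × p x ≡ false
  all⁻-false p (x ∷ xs) e with p x in ex
  ... | false = x , here refl , ex
  ... | true with all⁻-false p xs e
  ... | y , m , ey = y , there m , ey

  allFin⁻ : ∀ {n} (p : Fin n → Bool) → all p (allFin n) ≡ true → ∀ i → p i ≡ true
  allFin⁻ {n} p h i = all⁻ p (allFin n) h (∈-allFin i)

  allFin⁺ : ∀ {n} (p : Fin n → Bool) → (∀ i → p i ≡ true) → all p (allFin n) ≡ true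
  allFin⁺ {n} p h = all⁺ p (allFin n) (λ {x} _ → h x)

  subset-ext : ∀ {n} {u v : Subset n} → (∀ i → lookup u i ≡ lookup v i) → u ≡ v
  subset-ext {u = []} {[]} _ = refl
  subset-ext {u = x ∷ u} {y ∷ v} h = cong₂ _∷_ (h zero) (subset-ext (h ∘ suc))

  ∈∩ : ∀ {n} (A B : Subset n) i → i ∈ᵇ (A ∩ B) ≡ (i ∈ᵇ A ∧ i ∈ᵇ B)
  ∈∩ A B i = VP.lookup-zipWith _∧_ i A B

  ∈∪ : ∀ {n} (A B : Subset n) i → i ∈ᵇ (A ∪ B) ≡ (i ∈ᵇ A ∨ i ∈ᵇ B)
  ∈∪ A B i = VP.lookup-zipWith _∨_ i A B

  ∈∁ : ∀ {n} (A : Subset n) i → i ∈ᵇ (∁ A) ≡ not (i ∈ᵇ A)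
  ∈∁ A i = VP.lookup-map i not A

  ∈⊤ : ∀ {n} (i : Fin n) → i ∈ᵇ ⊤ ≡ true
  ∈⊤ i = VP.lookup-replicate i true

  ∈─ : ∀ {n} (A B : Subset n) i → i ∈ᵇ (A ─ B) ≡ (i ∈ᵇ A ∧ not (i ∈ᵇ B))
  ∈─ (a ∷ A) (true ∷ B) zero = sym (BP.∧-zeroʳ a)
  ∈─ (a ∷ A) (false ∷ B) zero = sym (BP.∧-identityʳ a)
  ∈─ (_ ∷ A) (_ ∷ B) (suc i) = ∈─ A B i

  ∈─⇒∈ : ∀ {n} (A B : Subset n) i → i ∈ᵇ (A ─ B) ≡ true → i ∈ᵇ A ≡ true
  ∈─⇒∈ A B i e = ∧T₁ (trans (sym (∈─ A B i)) e)

  ∈⇒∉─ : ∀ {n} (A B : Subset n) i → i ∈ᵇ B ≡ true → i ∈ᵇ (A ─ B) ≡ false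
  ∈⇒∉─ A B i e = trans (∈─ A B i) (trans (cong (λ b → i ∈ᵇ A ∧ not b) e) (BP.∧-zeroʳ (i ∈ᵇ A)))

  ∉⇒∈∁ : ∀ {n} (S : Subset n) i → i ∈ᵇ S ≡ false → i ∈ᵇ ∁ S ≡ true
  ∉⇒∈∁ S i e = trans (∈∁ S i) (cong not e)

  ∈⇒∉∁ : ∀ {n} (S : Subset n) i → i ∈ᵇ S ≡ true → i ∈ᵇ ∁ S ≡ false
  ∈⇒∉∁ S i e = trans (∈∁ S i) (cong not e)

  ∈∁⇒∉ : ∀ {n} (S : Subset n) i → i ∈ᵇ ∁ S ≡ true → i ∈ᵇ S ≡ false
  ∈∁⇒∉ S i e = not-true (trans (sym (∈∁ S i)) e)

  ∈S∪∁S : ∀ {n} (S : Subset n) i → i ∈ᵇ (S ∪ ∁ S) ≡ i ∈ᵇ ⊤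
  ∈S∪∁S S i = trans (∈∪ S (∁ S) i) (trans (cong (i ∈ᵇ S ∨_) (∈∁ S i))
                (trans (BP.∨-inverseʳ (i ∈ᵇ S)) (sym (∈⊤ i))))

  S∩∁S-empty : ∀ {n} (S : Subset n) i → (i ∈ᵇ S ∧ i ∈ᵇ ∁ S) ≡ false
  S∩∁S-empty S i = trans (cong (i ∈ᵇ S ∧_) (∈∁ S i)) (BP.∧-inverseʳ (i ∈ᵇ S))

  NonEmpty Empty : ∀ {n} → Subset n → Set
  NonEmpty L = ∃ λ i → i ∈ᵇ L ≡ true
  Empty U = ∀ i → i ∈ᵇ U ≡ false

  Sub : ∀ {n} → Subset n → Subset n → Set
  Sub A B = ∀ i → i ∈ᵇ A ≡ true → i ∈ᵇ B ≡ true

  Disj : ∀ {n} → Subset n → Subset n → Set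
  Disj V L = ∀ i → i ∈ᵇ L ≡ true → i ∈ᵇ V ≡ false

  nonemptyᵇ⁻ : ∀ {n} (L : Subset n) → nonemptyᵇ L ≡ true → NonEmpty L
  nonemptyᵇ⁻ {n} L h with any⁻ (λ i → i ∈ᵇ L) (allFin n) h
  ... | i , _ , e = i , e

  nonemptyᵇ⁺ : ∀ {n} (L : Subset n) → NonEmpty L → nonemptyᵇ L ≡ true
  nonemptyᵇ⁺ {n} L (i , e) = any⁺ (λ i → i ∈ᵇ L) (allFin n) (∈-allFin i) e

  emptyᵇ⁻ : ∀ {n} (L : Subset n) → nonemptyᵇ L ≡ false → Empty L
  emptyᵇ⁻ L h i = ≢true⇒false (λ e → false≢true (trans (sym h) (nonemptyᵇ⁺ L (i , e))))

  emptyᵇ⁺ : ∀ {n} (L : Subset n) → Empty L → nonemptyᵇ L ≡ false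
  emptyᵇ⁺ L h = ≢true⇒false (λ e → let (i , e') = nonemptyᵇ⁻ L e in false≢true (trans (sym (h i)) e'))

  empty∩ : ∀ {n} (V X : Subset n) → nonemptyᵇ (V ∩ X) ≡ false → ∀ i → (i ∈ᵇ V ∧ i ∈ᵇ X) ≡ false
  empty∩ V X e i = trans (sym (∈∩ V X i)) (emptyᵇ⁻ (V ∩ X) e i)

  empty∩⇒∉ʳ : ∀ {n} (V X : Subset n) → nonemptyᵇ (V ∩ X) ≡ false → ∀ i → i ∈ᵇ V ≡ true → i ∈ᵇ X ≡ false
  empty∩⇒∉ʳ V X e i ev = trans (sym (BP.∧-identityˡ (i ∈ᵇ X))) (trans (cong (_∧ i ∈ᵇ X) (sym ev)) (empty∩ V X e i))

  empty∩⇒∉ˡ : ∀ {n} (V X : Subset n) → nonemptyᵇ (V ∩ X) ≡ false → ∀ i → i ∈ᵇ X ≡ true → i ∈ᵇ V ≡ false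
  empty∩⇒∉ˡ V X e i ex = trans (sym (BP.∧-identityʳ (i ∈ᵇ V))) (trans (cong (i ∈ᵇ V ∧_) (sym ex)) (empty∩ V X e i))

  ∩-⊆ : ∀ {n} (V X : Subset n) → Sub X V → V ∩ X ≡ X
  ∩-⊆ V X h = subset-ext λ i → trans (∈∩ V X i) (by-membership i (i ∈ᵇ X) refl)
    where
    by-membership : ∀ i b → i ∈ᵇ X ≡ b → (i ∈ᵇ V ∧ i ∈ᵇ X) ≡ i ∈ᵇ X
    by-membership i true e rewrite e | h i e = refl
    by-membership i false e rewrite e = BP.∧-zeroʳ _

  ∩-disjoint : ∀ {n} (V X : Subset n) → Disj V X → Empty (V ∩ X)
  ∩-disjoint V X d i = trans (∈∩ V X i) (by-membership (i ∈ᵇ X) refl)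
    where
    by-membership : ∀ b → i ∈ᵇ X ≡ b → (i ∈ᵇ V ∧ i ∈ᵇ X) ≡ false
    by-membership true e rewrite e | d i e = refl
    by-membership false e rewrite e = BP.∧-zeroʳ _

  filter-cons : ∀ {a} {A : Set a} (p : A → Bool) x xs →
    filterᵇ p (x ∷ xs) ≡ (if p x then x ∷ filterᵇ p xs else filterᵇ p xs)
  filter-cons p x xs with p x
  ... | true = refl
  ... | false = refl

  filter-accept : ∀ {a} {A : Set a} (p : A → Bool) x xs → p x ≡ true → filterᵇ p (x ∷ xs) ≡ x ∷ filterᵇ p xs
  filter-accept p x xs e rewrite filter-cons p x xs | e = refl

  filter-reject : ∀ {a} {A : Set a} (p : A → Bool) x xs → p x ≡ false → filterᵇ p (x ∷ xs) ≡ filterᵇ p xs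
  filter-reject p x xs e rewrite filter-cons p x xs | e = refl

  CompOf : ∀ {n} → Subset n → Comp n → Set
  CompOf U [] = Empty U
  CompOf U (L ∷ K) = NonEmpty L × Sub L U × CompOf (U ─ L) K

  CompOf-cong : ∀ {n} {U V : Subset n} K → (∀ i → i ∈ᵇ U ≡ i ∈ᵇ V) → CompOf U K → CompOf V K
  CompOf-cong K h c = subst (λ W → CompOf W K) (subset-ext h) c

  CompOf-nonempty : ∀ {n} (S : Subset n) K → CompOf S K → All NonEmpty K
  CompOf-nonempty S [] _ = []
  CompOf-nonempty S (L ∷ K) (ne , _ , c) = ne ∷ CompOf-nonempty (S ─ L) K c

  multiplicity : ∀ {n} → Fin n → Comp n → ℕ
  multiplicity i K = count (λ L → i ∈ᵇ L) K

  multiplicity-∷ : ∀ {n} (i : Fin n) L K →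
    multiplicity i (L ∷ K) ≡ (if i ∈ᵇ L then suc (multiplicity i K) else multiplicity i K)
  multiplicity-∷ i L K with i ∈ᵇ L
  ... | true = refl
  ... | false = refl

  ind₀₁ : Bool → ℕ
  ind₀₁ b = if b then 1 else 0

  Counts : ∀ {n} → Subset n → Comp n → Set
  Counts S K = ∀ i → multiplicity i K ≡ ind₀₁ (i ∈ᵇ S)

  CompOf⇒Counts : ∀ {n} (S : Subset n) K → CompOf S K → Counts S K
  CompOf⇒Counts S [] h i rewrite h i = refl
  CompOf⇒Counts S (L ∷ K) (ne , sub , c) i with CompOf⇒Counts (S ─ L) K c i
  ... | ih rewrite multiplicity-∷ i L K | ∈─ S L i with i ∈ᵇ L in eL
  ... | true rewrite sub i eL | ih = refl
  ... | false rewrite ih with i ∈ᵇ S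
  ... | true = refl
  ... | false = refl

  Counts⇒CompOf : ∀ {n} (S : Subset n) K → All NonEmpty K → Counts S K → CompOf S K
  Counts⇒CompOf S [] _ h i with i ∈ᵇ S in e | h i
  ... | false | _ = refl
  Counts⇒CompOf S (L ∷ K) (ne ∷ nes) h = ne , L⊆S , Counts⇒CompOf (S ─ L) K nes rest
    where
    L⊆S : Sub L S
    L⊆S i eL with h i
    ... | hi rewrite multiplicity-∷ i L K | eL with i ∈ᵇ S
    ... | true = refl
    rest : Counts (S ─ L) K
    rest i with h i
    ... | hi rewrite multiplicity-∷ i L K | ∈─ S L i with i ∈ᵇ L
    ... | true with i ∈ᵇ S
    ... | true = NP.suc-injective hi
    rest i | hi | false with i ∈ᵇ S
    ... | true = hi
    ... | false = hi

  isComp⇒CompOf : ∀ {n} (S : Subset n) K → isComp S K ≡ true → CompOf S K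
  isComp⇒CompOf S K h =
    Counts⇒CompOf S K (lumps K (∧T₁ h)) (λ i → count-eq i (allFin⁻ _ (∧T₂ {all nonemptyᵇ K} h) i))
    where
    lumps : ∀ K → all nonemptyᵇ K ≡ true → All NonEmpty K
    lumps [] _ = []
    lumps (L ∷ K) e = nonemptyᵇ⁻ L (∧T₁ e) ∷ lumps K (∧T₂ {nonemptyᵇ L} e)
    count-eq : ∀ i → (multiplicity i K ≡ᵇ ind₀₁ (i ∈ᵇ S)) ≡ true → multiplicity i K ≡ ind₀₁ (i ∈ᵇ S)
    count-eq i e = NP.≡ᵇ⇒≡ _ _ (true⇒T e)

  CompOf⇒isComp : ∀ {n} (S : Subset n) K → CompOf S K → isComp S K ≡ true
  CompOf⇒isComp S K c = ∧I (lumps K (CompOf-nonempty S K c)) (allFin⁺ _ λ i → count-eq i (CompOf⇒Counts S K c i))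
    where
    lumps : ∀ K → All NonEmpty K → all nonemptyᵇ K ≡ true
    lumps [] _ = refl
    lumps (L ∷ K) (ne ∷ h) = ∧I (nonemptyᵇ⁺ L ne) (lumps K h)
    count-eq : ∀ i → multiplicity i K ≡ ind₀₁ (i ∈ᵇ S) → (multiplicity i K ≡ᵇ ind₀₁ (i ∈ᵇ S)) ≡ true
    count-eq i e rewrite e with i ∈ᵇ S
    ... | true = refl
    ... | false = refl

  CompOf-lumps : ∀ {n} (U : Subset n) K → CompOf U K → All (λ L → Sub L U) K
  CompOf-lumps U [] c = []
  CompOf-lumps U (L ∷ K) (ne , sub , c) =
    sub ∷ All.map (λ s i e → ∈─⇒∈ U L i (s i e)) (CompOf-lumps (U ─ L) K c)

  covers : ∀ {n} → Comp n → Fin n → Bool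
  covers [] j = false
  covers (L ∷ K) j = j ∈ᵇ L ∨ covers K j

  CompOf-covers : ∀ {n} (U : Subset n) K → CompOf U K → ∀ j → covers K j ≡ j ∈ᵇ U
  CompOf-covers U [] c j = sym (c j)
  CompOf-covers U (L ∷ K) (ne , sub , c) j rewrite CompOf-covers (U ─ L) K c j | ∈─ U L j with j ∈ᵇ L in e
  ... | true = sym (sub j e)
  ... | false with j ∈ᵇ U
  ... | true = refl
  ... | false = refl

  first-lump-not-covered : ∀ {n} U X (A : Comp n) → CompOf (U ─ X) A → ∀ i → i ∈ᵇ X ≡ true → covers A i ≡ false
  first-lump-not-covered U X A c i e = trans (CompOf-covers _ A c i) (∈⇒∉─ U X i e)

  rel-on-positions : Maybe ℕ → Maybe ℕ → Bool
  rel-on-positions (just a) (just b) = a ≤ᵇ b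
  rel-on-positions _ _ = false

  rel-via-pos : ∀ {n} (K : Comp n) i j → rel K i j ≡ rel-on-positions (pos K i) (pos K j)
  rel-via-pos K i j with pos K i | pos K j
  ... | just a | just b = refl
  ... | just a | nothing = refl
  ... | nothing | just b = refl
  ... | nothing | nothing = refl

  covers-via-pos : ∀ {n} (K : Comp n) j → covers K j ≡ is-just (pos K j)
  covers-via-pos [] j = refl
  covers-via-pos (L ∷ K) j with j ∈ᵇ L
  ... | true = refl
  ... | false rewrite covers-via-pos K j with pos K j
  ... | just _ = refl
  ... | nothing = refl

  private
    suc≤ᵇsuc : ∀ a b → (suc a ≤ᵇ suc b) ≡ (a ≤ᵇ b)
    suc≤ᵇsuc zero b = refl
    suc≤ᵇsuc (suc a) b = refl

  rel-∷ : ∀ {n} L (K : Comp n) i j →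
    rel (L ∷ K) i j ≡ (if i ∈ᵇ L then (j ∈ᵇ L ∨ covers K j) else (not (j ∈ᵇ L) ∧ rel K i j))
  rel-∷ L K i j rewrite rel-via-pos (L ∷ K) i j | rel-via-pos K i j | covers-via-pos K j with i ∈ᵇ L | j ∈ᵇ L
  ... | true | true = refl
  ... | true | false with pos K j
  ... | just _ = refl
  ... | nothing = refl
  rel-∷ L K i j | false | true with pos K i
  ... | just _ = refl
  ... | nothing = refl
  rel-∷ L K i j | false | false with pos K i | pos K j
  ... | just a | just b = suc≤ᵇsuc a b
  ... | just a | nothing = refl
  ... | nothing | just b = refl
  ... | nothing | nothing = refl

  rel-∷-in : ∀ {n} X (A : Comp n) i j → i ∈ᵇ X ≡ true → rel (X ∷ A) i j ≡ covers (X ∷ A) j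
  rel-∷-in X A i j e rewrite rel-∷ X A i j | e = refl

  rel-∷-out : ∀ {n} X (A : Comp n) i j → i ∈ᵇ X ≡ false → rel (X ∷ A) i j ≡ (not (j ∈ᵇ X) ∧ rel A i j)
  rel-∷-out X A i j e rewrite rel-∷ X A i j | e = refl

  rel-∷-to-first : ∀ {n} X (A : Comp n) x₀ → x₀ ∈ᵇ X ≡ true → ∀ i → rel (X ∷ A) i x₀ ≡ i ∈ᵇ X
  rel-∷-to-first X A x₀ e i rewrite rel-∷ X A i x₀ | e with i ∈ᵇ X
  ... | true = refl
  ... | false = refl

  uncovered⇒¬rel₁ : ∀ {n} (K : Comp n) i j → covers K i ≡ false → rel K i j ≡ false
  uncovered⇒¬rel₁ K i j h rewrite rel-via-pos K i j | covers-via-pos K i with pos K i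
  uncovered⇒¬rel₁ K i j () | just _
  ... | nothing = refl

  uncovered⇒¬rel₂ : ∀ {n} (K : Comp n) i j → covers K j ≡ false → rel K i j ≡ false
  uncovered⇒¬rel₂ K i j h rewrite rel-via-pos K i j | covers-via-pos K j with pos K i | pos K j
  uncovered⇒¬rel₂ K i j () | _ | just _
  ... | just _ | nothing = refl
  ... | nothing | nothing = refl

  rel⇒covers₁ : ∀ {n} (K : Comp n) i j → rel K i j ≡ true → covers K i ≡ true
  rel⇒covers₁ K i j h with covers K i in e
  ... | true = refl
  ... | false = ⊥-elim (false≢true (trans (sym (uncovered⇒¬rel₁ K i j e)) h))

  rel⇒covers₂ : ∀ {n} (K : Comp n) i j → rel K i j ≡ true → covers K j ≡ true
  rel⇒covers₂ K i j h with covers K j in e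
  ... | true = refl
  ... | false = ⊥-elim (false≢true (trans (sym (uncovered⇒¬rel₂ K i j e)) h))

  rel-total : ∀ {n} (K : Comp n) i j → covers K i ≡ true → covers K j ≡ true → rel K i j ≡ true ⊎ rel K j i ≡ true
  rel-total K i j ci cj rewrite rel-via-pos K i j | rel-via-pos K j i | covers-via-pos K i | covers-via-pos K j
    with pos K i | pos K j
  ... | just a | just b with a ≤ᵇ b in e
  ... | true = inj₁ refl
  ... | false = inj₂ (≤⇒≤ᵇtrue {b} {a} (NP.<⇒≤ (NP.≰⇒> (λ le → false≢true (trans (sym e) (≤⇒≤ᵇtrue le))))))

  rel-injective : ∀ {n} (U : Subset n) A B → CompOf U A → CompOf U B → (∀ i j → rel A i j ≡ rel B i j) → A ≡ B
  rel-injective U [] [] cA cB h = refl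
  rel-injective U [] (Y ∷ B) cA ((y , ey) , sub , _) h = ⊥-elim (false≢true (trans (sym (cA y)) (sub y ey)))
  rel-injective U (X ∷ A) [] ((x , ex) , sub , _) cB h = ⊥-elim (false≢true (trans (sym (cB x)) (sub x ex)))
  rel-injective U (X ∷ A) (Y ∷ B) cA@((x₀ , ex) , subX , cA') cB@((y₀ , ey) , subY , cB') h
    = cong₂ _∷_ X≡Y (rel-injective (U ─ X) A B cA' cB'' tails)
    where
    -- the first lumps agree: both are the set of points preceding x₀
    x₀∈Y : x₀ ∈ᵇ Y ≡ true
    x₀∈Y = trans (sym (rel-∷-to-first Y B y₀ ey x₀)) (trans (sym (h x₀ y₀))
            (trans (rel-∷-in X A x₀ y₀ ex) (trans (CompOf-covers U (X ∷ A) cA y₀) (subY y₀ ey))))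
    X≡Y : X ≡ Y
    X≡Y = subset-ext (λ i → trans (sym (rel-∷-to-first X A x₀ ex i)) (trans (h i x₀) (rel-∷-to-first Y B x₀ x₀∈Y i)))
    cB'' : CompOf (U ─ X) B
    cB'' = subst (λ Z → CompOf (U ─ Z) B) (sym X≡Y) cB'
    tails : ∀ i j → rel A i j ≡ rel B i j
    tails i j with i ∈ᵇ X in eiX
    ... | true = trans (uncovered⇒¬rel₁ A i j (first-lump-not-covered U X A cA' i eiX))
                   (sym (uncovered⇒¬rel₁ B i j (first-lump-not-covered U X B cB'' i eiX)))
    ... | false with j ∈ᵇ X in ejX
    ... | true = trans (uncovered⇒¬rel₂ A i j (first-lump-not-covered U X A cA' j ejX))
                   (sym (uncovered⇒¬rel₂ B i j (first-lump-not-covered U X B cB'' j ejX)))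
    ... | false = trans (sym (trans (rel-∷-out X A i j eiX) (cong (λ b → not b ∧ rel A i j) ejX)))
                   (trans (h i j) (trans (rel-∷-out Y B i j (trans (cong (i ∈ᵇ_) (sym X≡Y)) eiX))
                     (cong (λ b → not b ∧ rel B i j) (trans (cong (j ∈ᵇ_) (sym X≡Y)) ejX))))

  restrict-∷ : ∀ {n} L (K : Comp n) V →
    restrict (L ∷ K) V ≡ (if nonemptyᵇ (V ∩ L) then (V ∩ L) ∷ restrict K V else restrict K V)
  restrict-∷ L K V = filter-cons nonemptyᵇ (V ∩ L) (List.map (V ∩_) K)

  restrict-keep : ∀ {n} L (K : Comp n) V → nonemptyᵇ (V ∩ L) ≡ true → restrict (L ∷ K) V ≡ (V ∩ L) ∷ restrict K V
  restrict-keep L K V e rewrite restrict-∷ L K V | e = refl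

  restrict-drop : ∀ {n} L (K : Comp n) V → nonemptyᵇ (V ∩ L) ≡ false → restrict (L ∷ K) V ≡ restrict K V
  restrict-drop L K V e rewrite restrict-∷ L K V | e = refl

  restrict-∷-cong : ∀ {n} (X X' : Subset n) (R : Comp n) V → V ∩ X ≡ V ∩ X' → restrict (X ∷ R) V ≡ restrict (X' ∷ R) V
  restrict-∷-cong X X' R V e rewrite restrict-∷ X R V | restrict-∷ X' R V | e = refl

  restrict-∷-tail : ∀ {n} (X : Subset n) (R R' : Comp n) V → restrict R V ≡ restrict R' V →
    restrict (X ∷ R) V ≡ restrict (X ∷ R') V
  restrict-∷-tail X R R' V e rewrite restrict-∷ X R V | restrict-∷ X R' V | e = refl

  restrict-∷-⊆ : ∀ {n} (V A : Subset n) (M : Comp n) → Sub A V → NonEmpty A → restrict (A ∷ M) V ≡ A ∷ restrict M V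
  restrict-∷-⊆ V A M s ne = trans (restrict-keep A M V (nonemptyᵇ⁺ (V ∩ A) (subst NonEmpty (sym eq) ne)))
                              (cong (_∷ restrict M V) eq)
    where eq = ∩-⊆ V A s

  restrict-∷-disjoint : ∀ {n} (V B : Subset n) (M : Comp n) → Disj V B → restrict (B ∷ M) V ≡ restrict M V
  restrict-∷-disjoint V B M d = restrict-drop B M V (emptyᵇ⁺ (V ∩ B) (∩-disjoint V B d))

  restrict-++ : ∀ {n} (A B : Comp n) V → restrict (A List.++ B) V ≡ restrict A V List.++ restrict B V
  restrict-++ [] B V = refl
  restrict-++ (L ∷ A) B V with nonemptyᵇ (V ∩ L)
  ... | true = cong (V ∩ L ∷_) (restrict-++ A B V)
  ... | false = restrict-++ A B V

  restrict-⊆ : ∀ {n} (A : Comp n) V → All (λ L → Sub L V) A → All NonEmpty A → restrict A V ≡ A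
  restrict-⊆ [] V _ _ = refl
  restrict-⊆ (L ∷ A) V (s ∷ ss) (ne ∷ nes) = trans (restrict-∷-⊆ V L A s ne) (cong (L ∷_) (restrict-⊆ A V ss nes))

  restrict-disjoint : ∀ {n} (A : Comp n) V → All (Disj V) A → restrict A V ≡ []
  restrict-disjoint [] V _ = refl
  restrict-disjoint (L ∷ A) V (d ∷ ds) = trans (restrict-∷-disjoint V L A d) (restrict-disjoint A V ds)

  covers-restrict : ∀ {n} (K : Comp n) V j → covers (restrict K V) j ≡ (j ∈ᵇ V ∧ covers K j)
  covers-restrict [] V j = sym (BP.∧-zeroʳ (j ∈ᵇ V))
  covers-restrict (L ∷ K) V j with nonemptyᵇ (V ∩ L) in e
  ... | true rewrite covers-restrict K V j | ∈∩ V L j = sym (BP.∧-distribˡ-∨ (j ∈ᵇ V) (j ∈ᵇ L) (covers K j))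
  ... | false rewrite covers-restrict K V j =
    sym (trans (BP.∧-distribˡ-∨ (j ∈ᵇ V) (j ∈ᵇ L) (covers K j)) (cong (_∨ (j ∈ᵇ V ∧ covers K j)) (empty∩ V L e j)))

  rel-restrict : ∀ {n} (K : Comp n) V i j → rel (restrict K V) i j ≡ (i ∈ᵇ V ∧ (j ∈ᵇ V ∧ rel K i j))
  rel-restrict [] V i j with i ∈ᵇ V | j ∈ᵇ V
  ... | true | true = refl
  ... | true | false = refl
  ... | false | _ = refl
  rel-restrict (L ∷ K) V i j with nonemptyᵇ (V ∩ L) in e
  ... | true rewrite rel-∷ (V ∩ L) (restrict K V) i j | rel-∷ L K i j
                   | covers-restrict K V j | rel-restrict K V i j | ∈∩ V L i | ∈∩ V L j
    = kept (i ∈ᵇ V) (i ∈ᵇ L) (j ∈ᵇ V) (j ∈ᵇ L) (covers K j) (rel K i j)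
    where
    kept : ∀ vi li vj lj c r →
      (if vi ∧ li then ((vj ∧ lj) ∨ (vj ∧ c)) else (not (vj ∧ lj) ∧ (vi ∧ (vj ∧ r))))
      ≡ (vi ∧ (vj ∧ (if li then (lj ∨ c) else (not lj ∧ r))))
    kept true true true lj c r = refl
    kept true true false lj c r = refl
    kept true false true true c r = refl
    kept true false true false c r = refl
    kept true false false lj c r = refl
    kept false li true true c r = refl
    kept false li true false c r = refl
    kept false li false lj c r = refl
  ... | false rewrite rel-∷ L K i j | rel-restrict K V i j
    = dropped (i ∈ᵇ V) (i ∈ᵇ L) (j ∈ᵇ V) (j ∈ᵇ L) (covers K j) (rel K i j) (empty∩ V L e i) (empty∩ V L e j)
    where
    dropped : ∀ vi li vj lj c r → (vi ∧ li) ≡ false → (vj ∧ lj) ≡ false →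
      (vi ∧ (vj ∧ r)) ≡ (vi ∧ (vj ∧ (if li then (lj ∨ c) else (not lj ∧ r))))
    dropped true false true false c r _ _ = refl
    dropped true false false lj c r _ _ = refl
    dropped false li vj lj c r _ _ = refl

  CompOf-restrict : ∀ {n} (U : Subset n) K V → CompOf U K → CompOf (U ∩ V) (restrict K V)
  CompOf-restrict U [] V c i rewrite ∈∩ U V i | c i = refl
  CompOf-restrict U (L ∷ K) V (ne , sub , c) with nonemptyᵇ (V ∩ L) in e
  ... | true = nonemptyᵇ⁻ (V ∩ L) e , lump⊆ , CompOf-cong (restrict K V) rest-kept ih
    where
    ih = CompOf-restrict (U ─ L) K V c
    lump⊆ : Sub (V ∩ L) (U ∩ V)
    lump⊆ i h = let h' = trans (sym (∈∩ V L i)) h in trans (∈∩ U V i) (∧I (sub i (∧T₂ {i ∈ᵇ V} h')) (∧T₁ h'))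
    table : ∀ u v l → ((u ∧ not l) ∧ v) ≡ ((u ∧ v) ∧ not (v ∧ l))
    table true true true = refl
    table true true false = refl
    table true false true = refl
    table true false false = refl
    table false v l = refl
    rest-kept : ∀ i → i ∈ᵇ ((U ─ L) ∩ V) ≡ i ∈ᵇ ((U ∩ V) ─ (V ∩ L))
    rest-kept i = trans (∈∩ (U ─ L) V i) (trans (cong (_∧ i ∈ᵇ V) (∈─ U L i))
      (trans (table (i ∈ᵇ U) (i ∈ᵇ V) (i ∈ᵇ L)) (sym (trans (∈─ (U ∩ V) (V ∩ L) i)
        (cong₂ (λ a b → a ∧ not b) (∈∩ U V i) (∈∩ V L i))))))
  ... | false = CompOf-cong (restrict K V) rest-dropped (CompOf-restrict (U ─ L) K V c)
    where
    table : ∀ u v l → (v ∧ l) ≡ false → ((u ∧ not l) ∧ v) ≡ (u ∧ v)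
    table true true false _ = refl
    table true false l _ = BP.∧-zeroʳ _
    table false v l _ = refl
    rest-dropped : ∀ i → i ∈ᵇ ((U ─ L) ∩ V) ≡ i ∈ᵇ (U ∩ V)
    rest-dropped i = trans (∈∩ (U ─ L) V i) (trans (cong (_∧ i ∈ᵇ V) (∈─ U L i))
      (trans (table (i ∈ᵇ U) (i ∈ᵇ V) (i ∈ᵇ L) (empty∩ V L e i)) (sym (∈∩ U V i))))

  CompOf-restrict-⊤ : ∀ {n} (H : Comp n) V → CompOf ⊤ H → CompOf V (restrict H V)
  CompOf-restrict-⊤ H V c = CompOf-cong (restrict H V) (λ i → trans (∈∩ ⊤ V i) (cong (_∧ i ∈ᵇ V) (∈⊤ i)))
                              (CompOf-restrict ⊤ H V c)

module Enumeration where

  open Compositions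
  open import Data.Bool using (true; false)
  open import Data.Nat using (zero; suc; _≤_; z≤n; s≤s)
  import Data.Nat.Properties as NP
  open import Data.Vec using ([]; _∷_; tail)
  import Data.Vec.Properties as VP
  open import Data.Fin.Subset using (Subset; _─_; ∣_∣; _⊂_) renaming (_∈_ to _∈ˢ_)
  open import Data.Fin.Subset.Properties using (∣p∣≤n; p⊂q⇒∣p∣<∣q∣)
  open import Data.List using (List; []; _∷_; upTo; concatMap; length; map; head)
  open import Data.List.Membership.Propositional using (_∈_; find)
  open import Data.List.Membership.Propositional.Properties
    using (∈-concatMap⁺; ∈-concatMap⁻; ∈-map⁺; ∈-map⁻; ∈-filter⁺; ∈-filter⁻; ∈-upTo⁺)
  open import Data.List.Relation.Unary.Any as Any using (here; there)
  open import Data.List.Relation.Unary.All as All using (All; []; _∷_)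
  open import Data.List.Relation.Unary.AllPairs using ([]; _∷_)
  open import Data.List.Relation.Unary.Unique.Propositional using (Unique)
  import Data.List.Relation.Unary.Unique.Propositional.Properties as UP
  open import Data.Maybe using (just)
  open import Data.Product using (_×_; _,_; proj₂)
  open import Relation.Nullary using (¬_)
  open import Relation.Nullary.Decidable using (T?)
  open import Relation.Binary.PropositionalEquality using (_≡_; refl; sym; trans; cong)
  open import Function using (_∘_; id)

  concatMap-unique : ∀ {a b c} {A : Set a} {B : Set b} {C : Set c} (f : A → List B) (g : B → C) (o : A → C) →
    (∀ {x y} → o x ≡ o y → x ≡ y) → (∀ x → Unique (f x)) → (∀ x {y} → y ∈ f x → g y ≡ o x) →
    ∀ xs → Unique xs → Unique (concatMap f xs)
  concatMap-unique f g o o-inj f-unique tag [] _ = []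
  concatMap-unique f g o o-inj f-unique tag (x ∷ xs) (x∉ ∷ u) =
    UP.++⁺ (f-unique x) (concatMap-unique f g o o-inj f-unique tag xs u) disjoint
    where
    disjoint : ∀ {v} → ¬ (v ∈ f x × v ∈ concatMap f xs)
    disjoint (m₁ , m₂) with find (∈-concatMap⁻ f {xs = xs} m₂)
    ... | x' , mx' , m₃ = All.lookup x∉ mx' (o-inj (trans (sym (tag x m₁)) (tag x' m₃)))

  allSubsets-complete : ∀ {n} (L : Subset n) → L ∈ allSubsets n
  allSubsets-complete [] = here refl
  allSubsets-complete {suc n} (b ∷ L) = ∈-concatMap⁺ _ (Any.map (λ { refl → head-choice b }) (allSubsets-complete L))
    where
    head-choice : ∀ b → (b ∷ L) ∈ ((true ∷ L) ∷ (false ∷ L) ∷ [])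
    head-choice true = here refl
    head-choice false = there (here refl)

  allSubsets-unique : ∀ n → Unique (allSubsets n)
  allSubsets-unique zero = [] ∷ []
  allSubsets-unique (suc n) = concatMap-unique (λ L → (true ∷ L) ∷ (false ∷ L) ∷ []) tail id id
    (λ L → ((λ ()) ∷ []) ∷ ([] ∷ [])) tag (allSubsets n) (allSubsets-unique n)
    where
    tag : ∀ L {y} → y ∈ ((true ∷ L) ∷ (false ∷ L) ∷ []) → tail y ≡ L
    tag L (here refl) = refl
    tag L (there (here refl)) = refl

  listsOfLength-complete : ∀ {a} {A : Set a} k (xs ys : List A) → length ys ≡ k → All (_∈ xs) ys →
    ys ∈ listsOfLength k xs
  listsOfLength-complete zero xs [] refl [] = here refl
  listsOfLength-complete (suc k) xs (y ∷ ys) refl (m ∷ ms) =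
    ∈-concatMap⁺ _ (Any.map (λ { refl → ∈-map⁺ (y ∷_) (listsOfLength-complete k xs ys refl ms) }) m)

  listsOfLength-length : ∀ {a} {A : Set a} k (xs : List A) {ys} → ys ∈ listsOfLength k xs → length ys ≡ k
  listsOfLength-length zero xs (here refl) = refl
  listsOfLength-length (suc k) xs m with find (∈-concatMap⁻ (λ x → map (x ∷_) (listsOfLength k xs)) {xs = xs} m)
  ... | x , _ , m' with ∈-map⁻ (x ∷_) m'
  ... | zs , mz , refl = cong suc (listsOfLength-length k xs mz)

  listsOfLength-unique : ∀ {a} {A : Set a} k (xs : List A) → Unique xs → Unique (listsOfLength k xs)
  listsOfLength-unique zero xs u = [] ∷ []
  listsOfLength-unique (suc k) xs u = concatMap-unique (λ x → map (x ∷_) (listsOfLength k xs)) head just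
    (λ { refl → refl }) (λ x → UP.map⁺ (λ { refl → refl }) (listsOfLength-unique k xs u)) tag xs u
    where
    tag : ∀ x {y} → y ∈ map (x ∷_) (listsOfLength k xs) → head y ≡ just x
    tag x m with ∈-map⁻ (x ∷_) m
    ... | _ , _ , refl = refl

  -- Removing a nonempty lump strictly shrinks U, so a composition of U has at
  -- most ∣ U ∣ lumps.
  remove-lump-⊂ : ∀ {n} (U L : Subset n) → NonEmpty L → Sub L U → (U ─ L) ⊂ U
  remove-lump-⊂ U L (i , i∈L) L⊆U =
    (λ {x} x∈ → ᵇ⇒∈ (∈─⇒∈ U L x (∈⇒ᵇ x∈))) , i , ᵇ⇒∈ (L⊆U i i∈L) ,
    (λ i∈ → false≢true (trans (sym (∈⇒∉─ U L i i∈L)) (∈⇒ᵇ i∈)))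
    where
    ∈⇒ᵇ : ∀ {V x} → x ∈ˢ V → x ∈ᵇ V ≡ true
    ∈⇒ᵇ = VP.[]=⇒lookup
    ᵇ⇒∈ : ∀ {V x} → x ∈ᵇ V ≡ true → x ∈ˢ V
    ᵇ⇒∈ {V} {x} = VP.lookup⇒[]= x V

  CompOf-length : ∀ {n} (U : Subset n) K → CompOf U K → length K ≤ ∣ U ∣
  CompOf-length U [] c = z≤n
  CompOf-length U (L ∷ K) (ne , L⊆U , c) =
    NP.≤-trans (s≤s (CompOf-length (U ─ L) K c)) (p⊂q⇒∣p∣<∣q∣ (remove-lump-⊂ U L ne L⊆U))

  comps-complete : ∀ {n} (S : Subset n) K → isComp S K ≡ true → K ∈ comps S
  comps-complete {n} S K e = ∈-filter⁺ (T? ∘ isComp S)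
    (∈-concatMap⁺ (λ k → listsOfLength k (allSubsets n)) {xs = upTo (suc n)}
      (Any.map (λ { refl → listsOfLength-complete (length K) (allSubsets n) K refl
          (All.tabulate λ {L} _ → allSubsets-complete L) })
        (∈-upTo⁺ (s≤s (NP.≤-trans (CompOf-length S K (isComp⇒CompOf S K e)) (∣p∣≤n S))))))
    (true⇒T e)

  comps-sound : ∀ {n} (S : Subset n) {K} → K ∈ comps S → isComp S K ≡ true
  comps-sound {n} S m =
    T⇒true (proj₂ (∈-filter⁻ (T? ∘ isComp S)
      {xs = concatMap (λ k → listsOfLength k (allSubsets n)) (upTo (suc n))} m))

  comps-unique : ∀ {n} (S : Subset n) → Unique (comps S)
  comps-unique {n} S = UP.filter⁺ (T? ∘ isComp S)
    (concatMap-unique (λ k → listsOfLength k (allSubsets n)) length id id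
      (λ k → listsOfLength-unique k _ (allSubsets-unique n)) (λ k m → listsOfLength-length k _ m)
      (upTo (suc n)) (UP.upTo⁺ (suc n)))

  CompOf⇒∈comps : ∀ {n} (S : Subset n) K → CompOf S K → K ∈ comps S
  CompOf⇒∈comps S K c = comps-complete S K (CompOf⇒isComp S K c)

  ∈comps⇒CompOf : ∀ {n} (S : Subset n) {K} → K ∈ comps S → CompOf S K
  ∈comps⇒CompOf S {K} m = isComp⇒CompOf S K (comps-sound S m)

module Merging where

  open Compositions
  open import Data.Bool using (Bool; true; false; _∧_; _∨_; not; if_then_else_)
  import Data.Bool.Properties as BP
  open import Data.Nat using (ℕ; suc; _+_)
  import Data.Nat.Properties as NP
  open import Data.Fin.Subset using (Subset; _∪_; _─_)
  open import Data.List using (List; []; _∷_; length; _++_)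
  import Data.List.Properties as LP
  open import Data.List.Membership.Propositional using (_∈_)
  open import Data.List.Relation.Unary.Any using (here; there)
  open import Data.List.Relation.Unary.All using (All; []; _∷_)
  open import Data.Product using (_,_)
  open import Data.Sum using (_⊎_; inj₁; inj₂)
  open import Relation.Binary.PropositionalEquality using (_≡_; refl; sym; trans; cong)

  private
    still-disjointˡ : ∀ v w a → (v ∧ w) ≡ false → ((v ∧ not a) ∧ w) ≡ false
    still-disjointˡ true false a _ = BP.∧-zeroʳ _
    still-disjointˡ false w a _ = refl
    still-disjointʳ : ∀ v w b → (v ∧ w) ≡ false → (v ∧ (w ∧ not b)) ≡ false
    still-disjointʳ true false b _ = refl
    still-disjointʳ false w b _ = refl
    rest-left : ∀ v w a → (a ≡ true → v ≡ true) → (v ∧ w) ≡ false → ((v ∧ not a) ∨ w) ≡ ((v ∨ w) ∧ not a)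
    rest-left true false true _ _ = refl
    rest-left true false false _ _ = refl
    rest-left false w true h _ with h refl
    ... | ()
    rest-left false true false _ _ = refl
    rest-left false false false _ _ = refl
    rest-right : ∀ v w b → (b ≡ true → w ≡ true) → (v ∧ w) ≡ false → (v ∨ (w ∧ not b)) ≡ ((v ∨ w) ∧ not b)
    rest-right true false true h _ with h refl
    ... | ()
    rest-right true false false _ _ = refl
    rest-right false w true _ _ = refl
    rest-right false w false _ _ = refl

  module _ {n : ℕ} (_≺_ : Subset n → Subset n → Bool) where

    merge : Comp n → Comp n → Comp n
    merge [] G = G
    merge (A ∷ F) [] = A ∷ F
    merge (A ∷ F) (B ∷ G) = if A ≺ B then A ∷ merge F (B ∷ G) else B ∷ merge (A ∷ F) G

    merge-length : ∀ F G → length (merge F G) ≡ length F + length G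
    merge-length [] G = refl
    merge-length (A ∷ F) [] = cong suc (sym (NP.+-identityʳ _))
    merge-length (A ∷ F) (B ∷ G) = step (merge-length F (B ∷ G)) (merge-length (A ∷ F) G)
      where
      step : length (merge F (B ∷ G)) ≡ length F + length (B ∷ G) →
        length (merge (A ∷ F) G) ≡ length (A ∷ F) + length G →
        length (merge (A ∷ F) (B ∷ G)) ≡ length (A ∷ F) + length (B ∷ G)
      step ih₁ ih₂ with A ≺ B
      ... | true = cong suc ih₁
      ... | false = cong suc (trans ih₂ (sym (NP.+-suc _ _)))

    merge-member : ∀ F G {Z} → Z ∈ merge F G → Z ∈ F ⊎ Z ∈ G
    merge-member [] G m = inj₂ m
    merge-member (A ∷ F) [] m = inj₁ m
    merge-member (A ∷ F) (B ∷ G) {Z} m with A ≺ B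
    ... | true with m
    ...   | here p = inj₁ (here p)
    ...   | there m' with merge-member F (B ∷ G) m'
    ...     | inj₁ x = inj₁ (there x)
    ...     | inj₂ x = inj₂ x
    merge-member (A ∷ F) (B ∷ G) {Z} m | false with m
    ...   | here p = inj₂ (here p)
    ...   | there m' with merge-member (A ∷ F) G m'
    ...     | inj₁ x = inj₁ x
    ...     | inj₂ x = inj₂ (there x)

    merge-head : ∀ A F G Y R → merge (A ∷ F) G ≡ Y ∷ R → (Y ≡ A) ⊎ (Y ∈ G)
    merge-head A F [] Y R refl = inj₁ refl
    merge-head A F (B ∷ G) Y R e with A ≺ B
    ... | true = inj₁ (sym (LP.∷-injectiveˡ e))
    ... | false = inj₂ (here (sym (LP.∷-injectiveˡ e)))

    merge-CompOf : ∀ V W F G → CompOf V F → CompOf W G → (∀ i → (i ∈ᵇ V ∧ i ∈ᵇ W) ≡ false) →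
      CompOf (V ∪ W) (merge F G)
    merge-CompOf V W [] G cF cG d = CompOf-cong G (λ i → sym (trans (∈∪ V W i) (cong (_∨ i ∈ᵇ W) (cF i)))) cG
    merge-CompOf V W (A ∷ F) [] cF cG d =
      CompOf-cong (A ∷ F) (λ i → sym (trans (∈∪ V W i) (trans (cong (i ∈ᵇ V ∨_) (cG i)) (BP.∨-identityʳ _)))) cF
    merge-CompOf V W (A ∷ F) (B ∷ G) cF@(neA , A⊆V , cF') cG@(neB , B⊆W , cG') d =
      step (merge-CompOf (V ─ A) W F (B ∷ G) cF' cG dˡ) (merge-CompOf V (W ─ B) (A ∷ F) G cF cG' dʳ)
      where
      dˡ : ∀ i → (i ∈ᵇ (V ─ A) ∧ i ∈ᵇ W) ≡ false
      dˡ i = trans (cong (_∧ i ∈ᵇ W) (∈─ V A i)) (still-disjointˡ (i ∈ᵇ V) (i ∈ᵇ W) (i ∈ᵇ A) (d i))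
      dʳ : ∀ i → (i ∈ᵇ V ∧ i ∈ᵇ (W ─ B)) ≡ false
      dʳ i = trans (cong (i ∈ᵇ V ∧_) (∈─ W B i)) (still-disjointʳ (i ∈ᵇ V) (i ∈ᵇ W) (i ∈ᵇ B) (d i))
      restˡ : ∀ i → i ∈ᵇ ((V ─ A) ∪ W) ≡ i ∈ᵇ ((V ∪ W) ─ A)
      restˡ i = trans (∈∪ (V ─ A) W i) (trans (cong (_∨ i ∈ᵇ W) (∈─ V A i))
        (trans (rest-left (i ∈ᵇ V) (i ∈ᵇ W) (i ∈ᵇ A) (A⊆V i) (d i))
          (sym (trans (∈─ (V ∪ W) A i) (cong (_∧ not (i ∈ᵇ A)) (∈∪ V W i))))))
      restʳ : ∀ i → i ∈ᵇ (V ∪ (W ─ B)) ≡ i ∈ᵇ ((V ∪ W) ─ B)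
      restʳ i = trans (∈∪ V (W ─ B) i) (trans (cong (i ∈ᵇ V ∨_) (∈─ W B i))
        (trans (rest-right (i ∈ᵇ V) (i ∈ᵇ W) (i ∈ᵇ B) (B⊆W i) (d i))
          (sym (trans (∈─ (V ∪ W) B i) (cong (_∧ not (i ∈ᵇ B)) (∈∪ V W i))))))
      step : CompOf ((V ─ A) ∪ W) (merge F (B ∷ G)) → CompOf (V ∪ (W ─ B)) (merge (A ∷ F) G) →
        CompOf (V ∪ W) (merge (A ∷ F) (B ∷ G))
      step ih₁ ih₂ with A ≺ B
      ... | true = neA , (λ i ea → trans (∈∪ V W i) (∨I₁ (A⊆V i ea))) , CompOf-cong _ restˡ ih₁
      ... | false = neB , (λ i eb → trans (∈∪ V W i) (∨I₂ {i ∈ᵇ V} (B⊆W i eb))) , CompOf-cong _ restʳ ih₂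

    merge-restrictˡ : ∀ V F G → All (λ L → Sub L V) F → All NonEmpty F → All (Disj V) G → restrict (merge F G) V ≡ F
    merge-restrictˡ V [] G _ _ dG = restrict-disjoint G V dG
    merge-restrictˡ V (A ∷ F) [] sF nF _ = restrict-⊆ (A ∷ F) V sF nF
    merge-restrictˡ V (A ∷ F) (B ∷ G) sF@(sA ∷ sF') nF@(nA ∷ nF') dG@(dB ∷ dG') =
      step (merge-restrictˡ V F (B ∷ G) sF' nF' dG) (merge-restrictˡ V (A ∷ F) G sF nF dG')
      where
      step : restrict (merge F (B ∷ G)) V ≡ F → restrict (merge (A ∷ F) G) V ≡ A ∷ F →
        restrict (merge (A ∷ F) (B ∷ G)) V ≡ A ∷ F
      step ih₁ ih₂ with A ≺ B
      ... | true = trans (restrict-∷-⊆ V A _ sA nA) (cong (A ∷_) ih₁)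
      ... | false = trans (restrict-∷-disjoint V B _ dB) ih₂

    merge-restrictʳ : ∀ V F G → All (Disj V) F → All (λ L → Sub L V) G → All NonEmpty G → restrict (merge F G) V ≡ G
    merge-restrictʳ V [] G _ sG nG = restrict-⊆ G V sG nG
    merge-restrictʳ V (A ∷ F) [] dF _ _ = restrict-disjoint (A ∷ F) V dF
    merge-restrictʳ V (A ∷ F) (B ∷ G) dF@(dA ∷ dF') sG@(sB ∷ sG') nG@(nB ∷ nG') =
      step (merge-restrictʳ V F (B ∷ G) dF' sG nG) (merge-restrictʳ V (A ∷ F) G dF sG' nG')
      where
      step : restrict (merge F (B ∷ G)) V ≡ B ∷ G → restrict (merge (A ∷ F) G) V ≡ G →
        restrict (merge (A ∷ F) (B ∷ G)) V ≡ B ∷ G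
      step ih₁ ih₂ with A ≺ B
      ... | true = trans (restrict-∷-disjoint V A _ dA) ih₁
      ... | false = trans (restrict-∷-⊆ V B _ sB nB) (cong (B ∷_) ih₂)

  merge-true : ∀ {n} (F G : Comp n) → merge (λ _ _ → true) F G ≡ F ++ G
  merge-true [] G = refl
  merge-true (A ∷ F) [] = cong (A ∷_) (sym (LP.++-identityʳ F))
  merge-true (A ∷ F) (B ∷ G) = cong (A ∷_) (merge-true F (B ∷ G))

-- Concatenations and initial segments.  "S is a union of an initial segment
-- of lumps of K" is read as S = covers (take m K); for a composition K of U
-- this holds iff no element of U outside S precedes an element of S in K.
module InitialSegments where

  open Compositions
  open Merging
  open import Data.Bool using (Bool; true; false; _∧_; _∨_; not)
  import Data.Bool.Properties as BP
  open import Data.Nat using (ℕ; zero; suc; _≤_; z≤n; s≤s)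
  open import Data.Fin using (Fin)
  open import Data.Fin.Subset using (Subset; _∩_; _∪_; _─_; ∁; ⊤)
  open import Data.List using (List; []; _∷_; allFin; upTo; length; take; drop; map; _++_)
  import Data.List.Properties as LP
  open import Data.Bool.ListAction using (or; all)
  open import Data.List.Membership.Propositional using (_∈_)
  open import Data.List.Membership.Propositional.Properties using (∈-upTo⁺)
  open import Data.List.Relation.Unary.Any using (here; there)
  open import Data.List.Relation.Unary.All as All using (All; []; _∷_)
  import Data.List.Relation.Unary.All.Properties as AllP
  open import Data.Product using (∃; _×_; _,_; proj₁; proj₂)
  open import Data.Sum using (inj₁; inj₂)
  open import Data.Empty using (⊥-elim)
  open import Relation.Binary.PropositionalEquality using (_≡_; refl; sym; trans; cong; cong₂; subst)

  covers-++ : ∀ {n} (A B : Comp n) j → covers (A ++ B) j ≡ (covers A j ∨ covers B j)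
  covers-++ [] B j = refl
  covers-++ (L ∷ A) B j rewrite covers-++ A B j = sym (BP.∨-assoc (j ∈ᵇ L) (covers A j) (covers B j))

  covers⁻ : ∀ {n} (A : Comp n) j → covers A j ≡ true → ∃ λ L → L ∈ A × j ∈ᵇ L ≡ true
  covers⁻ (L ∷ A) j e with ∨E {j ∈ᵇ L} e
  ... | inj₁ e' = L , here refl , e'
  ... | inj₂ e' with covers⁻ A j e'
  ... | L' , m , e'' = L' , there m , e''

  covers⁺ : ∀ {n} (A : Comp n) j {L} → L ∈ A → j ∈ᵇ L ≡ true → covers A j ≡ true
  covers⁺ (L ∷ A) j (here refl) e = ∨I₁ e
  covers⁺ (L ∷ A) j (there m) e = ∨I₂ {j ∈ᵇ L} (covers⁺ A j m e)

  CompOf-++ : ∀ {n} (V W : Subset n) A B → CompOf V A → CompOf W B → (∀ i → (i ∈ᵇ V ∧ i ∈ᵇ W) ≡ false) →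
    CompOf (V ∪ W) (A ++ B)
  CompOf-++ V W A B cA cB d = subst (CompOf (V ∪ W)) (merge-true A B) (merge-CompOf _ V W A B cA cB d)

  restrict-++ˡ : ∀ {n} V (A B : Comp n) → CompOf V A → All (Disj V) B → restrict (A ++ B) V ≡ A
  restrict-++ˡ V A B cA dB = trans (cong (λ Z → restrict Z V) (sym (merge-true A B)))
    (merge-restrictˡ _ V A B (CompOf-lumps V A cA) (CompOf-nonempty V A cA) dB)

  restrict-++ʳ : ∀ {n} W (A B : Comp n) → All (Disj W) A → CompOf W B → restrict (A ++ B) W ≡ B
  restrict-++ʳ W A B dA cB = trans (cong (λ Z → restrict Z W) (sym (merge-true A B)))
    (merge-restrictʳ _ W A B dA (CompOf-lumps W B cB) (CompOf-nonempty W B cB))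

  prefix-suffix-disjoint : ∀ {n} U (A B : Comp n) → CompOf U (A ++ B) → ∀ i → covers A i ≡ true → covers B i ≡ false
  prefix-suffix-disjoint U (X ∷ A) B (_ , _ , c) i e with ∨E {i ∈ᵇ X} e
  ... | inj₁ i∈X = ∨-false₂ (covers A i) (trans (sym (covers-++ A B i)) (first-lump-not-covered U X (A ++ B) c i i∈X))
  ... | inj₂ i∈A = prefix-suffix-disjoint (U ─ X) A B c i i∈A

  rel-++-prefix : ∀ {n} (A B : Comp n) i j → (∀ k → covers B k ≡ true → covers A k ≡ false) → covers A i ≡ true →
    rel (A ++ B) i j ≡ (rel A i j ∨ covers B j)
  rel-++-prefix (X ∷ A) B i j d ci = by-first-lump (i ∈ᵇ X) refl
    where
    table : ∀ x r b → (b ≡ true → x ≡ false) → (not x ∧ (r ∨ b)) ≡ ((not x ∧ r) ∨ b)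
    table true r true h with h refl
    ... | ()
    table true r false h = refl
    table false r b h = refl
    by-first-lump : ∀ b → i ∈ᵇ X ≡ b → rel (X ∷ A ++ B) i j ≡ (rel (X ∷ A) i j ∨ covers B j)
    by-first-lump true eX rewrite rel-∷-in X (A ++ B) i j eX | rel-∷-in X A i j eX | covers-++ A B j =
      sym (BP.∨-assoc (j ∈ᵇ X) (covers A j) (covers B j))
    by-first-lump false eX rewrite rel-∷-out X (A ++ B) i j eX | rel-∷-out X A i j eX
      | rel-++-prefix A B i j (λ k e → ∨-false₂ (k ∈ᵇ X) (d k e)) (subst (λ b → (b ∨ covers A i) ≡ true) eX ci) =
        table (j ∈ᵇ X) (rel A i j) (covers B j) (λ e → ∨-false₁ (j ∈ᵇ X) (d j e))

  rel-++-suffix : ∀ {n} (A B : Comp n) i j → covers A i ≡ false → rel (A ++ B) i j ≡ (not (covers A j) ∧ rel B i j)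
  rel-++-suffix [] B i j _ = refl
  rel-++-suffix (X ∷ A) B i j ci
    rewrite rel-∷-out X (A ++ B) i j (∨-false₁ (i ∈ᵇ X) ci) | rel-++-suffix A B i j (∨-false₂ (i ∈ᵇ X) ci)
    = table (j ∈ᵇ X) (covers A j) (rel B i j)
    where
    table : ∀ x c r → (not x ∧ (not c ∧ r)) ≡ (not (x ∨ c) ∧ r)
    table true c r = refl
    table false c r = refl

  private
    or-map-covers : ∀ {n} (A : Comp n) i → or (map (λ L → i ∈ᵇ L) A) ≡ covers A i
    or-map-covers [] i = refl
    or-map-covers (L ∷ A) i = cong (i ∈ᵇ L ∨_) (or-map-covers A i)

    ⇔ᵇ⇒≡ : ∀ a b → ((not a ∨ b) ∧ (not b ∨ a)) ≡ true → a ≡ b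
    ⇔ᵇ⇒≡ true true _ = refl
    ⇔ᵇ⇒≡ false false _ = refl

    ⇔ᵇ-refl : ∀ a → ((not a ∨ a) ∧ (not a ∨ a)) ≡ true
    ⇔ᵇ-refl true = refl
    ⇔ᵇ-refl false = refl

  IsPrefixUnion : ∀ {n} → Subset n → Comp n → ℕ → Set
  IsPrefixUnion S K m = ∀ i → i ∈ᵇ S ≡ covers (take m K) i

  isInitial⁻ : ∀ {n} S (K : Comp n) → isInitial S K ≡ true → ∃ λ m → IsPrefixUnion S K m
  isInitial⁻ S K e with any⁻ _ (upTo (suc (length K))) e
  ... | m , _ , e' = m , λ i → trans (⇔ᵇ⇒≡ (i ∈ᵇ S) _ (allFin⁻ _ e' i)) (or-map-covers (take m K) i)

  isInitial⁺ : ∀ {n} S (K : Comp n) m → m ≤ length K → IsPrefixUnion S K m → isInitial S K ≡ true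
  isInitial⁺ {n} S K m le h =
    any⁺ (λ m → all (λ i → (not (i ∈ᵇ S) ∨ u m i) ∧ (not (u m i) ∨ i ∈ᵇ S)) (allFin n))
      (upTo (suc (length K))) (∈-upTo⁺ (s≤s le))
      (allFin⁺ _ λ i → subst (λ b → ((not (i ∈ᵇ S) ∨ b) ∧ (not b ∨ i ∈ᵇ S)) ≡ true)
        (trans (h i) (sym (or-map-covers (take m K) i))) (⇔ᵇ-refl (i ∈ᵇ S)))
    where
    u : ℕ → Fin n → Bool
    u m i = or (map (λ L → i ∈ᵇ L) (take m K))

  NoBackward : ∀ {n} → Subset n → Comp n → Subset n → Set
  NoBackward U K S = ∀ i j → i ∈ᵇ U ≡ true → i ∈ᵇ S ≡ false → j ∈ᵇ S ≡ true → rel K i j ≡ false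

  prefix-no-backward : ∀ {n} m (K : Comp n) i j → covers (take m K) i ≡ false → covers (take m K) j ≡ true →
    rel K i j ≡ false
  prefix-no-backward zero K i j _ ()
  prefix-no-backward (suc m) [] i j _ ()
  prefix-no-backward (suc m) (L ∷ K) i j ei ej = trans (rel-∷-out L K i j (∨-false₁ (i ∈ᵇ L) ei))
      (by-lump (j ∈ᵇ L) refl ej)
    where
    by-lump : ∀ b → j ∈ᵇ L ≡ b → (b ∨ covers (take m K) j) ≡ true → (not (j ∈ᵇ L) ∧ rel K i j) ≡ false
    by-lump true e _ rewrite e = refl
    by-lump false e h rewrite e = prefix-no-backward m K i j (∨-false₂ (i ∈ᵇ L) ei) h

  -- Conversely, without backward pairs S ∩ U is a union of initial lumps: the
  -- first lump lies inside S as soon as it meets S, and otherwise it precedes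
  -- (hence excludes) every point of S ∩ U.
  module _ {n} (U : Subset n) (L : Subset n) (K : Comp n) (S : Subset n)
    (c : CompOf U (L ∷ K)) (h : NoBackward U (L ∷ K) S) where

    no-backward-tail : NoBackward (U ─ L) K S
    no-backward-tail i j i∈U─L i∉S j∈S = by-lump (j ∈ᵇ L) refl
      where
      i∉L : i ∈ᵇ L ≡ false
      i∉L = ≢true⇒false λ i∈L → false≢true (trans (sym (∈⇒∉─ U L i i∈L)) i∈U─L)
      by-lump : ∀ b → j ∈ᵇ L ≡ b → rel K i j ≡ false
      by-lump true ejL = uncovered⇒¬rel₂ K i j (first-lump-not-covered U L K (proj₂ (proj₂ c)) j ejL)
      by-lump false ejL = trans (sym (cong (λ b → not b ∧ rel K i j) ejL)) (trans (sym (rel-∷-out L K i j i∉L))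
                            (h i j (∈─⇒∈ U L i i∈U─L) i∉S j∈S))

    -- every point of L precedes a point s₀ ∈ S ∩ L, so lies in S
    first-lump-⊆ : nonemptyᵇ (S ∩ L) ≡ true → Sub L S
    first-lump-⊆ e x ex = x∈S
      where
      s₀ = proj₁ (nonemptyᵇ⁻ (S ∩ L) e)
      s₀∈S∩L : (s₀ ∈ᵇ S ∧ s₀ ∈ᵇ L) ≡ true
      s₀∈S∩L = trans (sym (∈∩ S L s₀)) (proj₂ (nonemptyᵇ⁻ (S ∩ L) e))
      x∈S : x ∈ᵇ S ≡ true
      x∈S with x ∈ᵇ S in exS
      ... | true = refl
      ... | false = ⊥-elim (false≢true (trans (sym (h x s₀ (proj₁ (proj₂ c) x ex) exS (∧T₁ s₀∈S∩L)))
                      (trans (rel-∷-in L K x s₀ ex) (∨I₁ (∧T₂ {s₀ ∈ᵇ S} s₀∈S∩L)))))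

    -- a point l₀ ∈ L ∖ S precedes every point of U, so no point of U lies in S
    first-lump-outside : nonemptyᵇ (S ∩ L) ≡ false → ∀ j → (j ∈ᵇ S ∧ j ∈ᵇ U) ≡ false
    first-lump-outside e j with j ∈ᵇ S in ejS | j ∈ᵇ U in ejU
    ... | false | _ = refl
    ... | true | false = refl
    ... | true | true = ⊥-elim (false≢true
        (trans (sym (h l₀ j (proj₁ (proj₂ c) l₀ l₀∈L) (empty∩⇒∉ˡ S L e l₀ l₀∈L) ejS))
            (trans (rel-∷-in L K l₀ j l₀∈L) (trans (CompOf-covers U (L ∷ K) c j) ejU))))
      where
      l₀ = proj₁ (proj₁ c)
      l₀∈L = proj₂ (proj₁ c)

  no-backward⇒prefix : ∀ {n} (U : Subset n) K S → CompOf U K → NoBackward U K S →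
    ∃ λ m → m ≤ length K × (∀ i → (i ∈ᵇ S ∧ i ∈ᵇ U) ≡ covers (take m K) i)
  no-backward⇒prefix U [] S c h = 0 , z≤n , λ i → trans (cong (i ∈ᵇ S ∧_) (c i)) (BP.∧-zeroʳ _)
  no-backward⇒prefix U (L ∷ K) S c h with nonemptyᵇ (S ∩ L) in e
  ... | true = let (m , le , eq) = no-backward⇒prefix (U ─ L) K S (proj₂ (proj₂ c)) (no-backward-tail U L K S c h) in
      suc m , s≤s le , λ i → trans (table (i ∈ᵇ S) (i ∈ᵇ U) (i ∈ᵇ L) (first-lump-⊆ U L K S c h e i)
          (proj₁ (proj₂ c) i))
        (cong (i ∈ᵇ L ∨_) (trans (cong (i ∈ᵇ S ∧_) (sym (∈─ U L i))) (eq i)))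
    where
    table : ∀ s u l → (l ≡ true → s ≡ true) → (l ≡ true → u ≡ true) → (s ∧ u) ≡ (l ∨ (s ∧ (u ∧ not l)))
    table s u true h₁ h₂ rewrite h₁ refl | h₂ refl = refl
    table true true false _ _ = refl
    table true false false _ _ = refl
    table false u false _ _ = refl
  ... | false = 0 , z≤n , first-lump-outside U L K S c h e

  prefix-lumps-⊆ : ∀ {n} (S : Subset n) K m → IsPrefixUnion S K m → All (λ L → Sub L S) (take m K)
  prefix-lumps-⊆ S K m h = All.tabulate λ mL i e → trans (h i) (covers⁺ (take m K) i mL e)

  suffix-lumps-disjoint : ∀ {n} (S : Subset n) K m → CompOf ⊤ K → IsPrefixUnion S K m → All (Disj S) (drop m K)
  suffix-lumps-disjoint S K m c h = All.tabulate λ mL i e → ≢true⇒false λ i∈S →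
    false≢true (trans (sym (prefix-suffix-disjoint ⊤ (take m K) (drop m K) c′ i (trans (sym (h i)) i∈S)))
      (covers⁺ (drop m K) i mL e))
    where
    c′ : CompOf ⊤ (take m K ++ drop m K)
    c′ = subst (CompOf ⊤) (sym (LP.take++drop≡id m K)) c

  restrict-prefix : ∀ {n} (S : Subset n) K m → CompOf ⊤ K → IsPrefixUnion S K m →
    (restrict K S ≡ take m K) × (restrict K (∁ S) ≡ drop m K)
  restrict-prefix {n} S K m c h =
    trans (cong (λ Z → restrict Z S) (sym (LP.take++drop≡id m K))) (trans (restrict-++ A B S)
      (trans (cong₂ _++_ (restrict-⊆ A S A⊆S (AllP.++⁻ˡ A lumps)) (restrict-disjoint B S B∩S)) (LP.++-identityʳ A))) ,
    trans (cong (λ Z → restrict Z (∁ S)) (sym (LP.take++drop≡id m K))) (trans (restrict-++ A B (∁ S))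
      (cong₂ _++_ (restrict-disjoint A (∁ S) A∩∁S) (restrict-⊆ B (∁ S) B⊆∁S (AllP.++⁻ʳ A lumps))))
    where
    A B : Comp n
    A = take m K
    B = drop m K
    lumps : All NonEmpty (A ++ B)
    lumps = subst (All NonEmpty) (sym (LP.take++drop≡id m K)) (CompOf-nonempty ⊤ K c)
    A⊆S = prefix-lumps-⊆ S K m h
    B∩S = suffix-lumps-disjoint S K m c h
    A∩∁S : All (Disj (∁ S)) A
    A∩∁S = All.map (λ L⊆S i e → ∈⇒∉∁ S i (L⊆S i e)) A⊆S
    B⊆∁S : All (λ L → Sub L (∁ S)) B
    B⊆∁S = All.map (λ L∩S i e → ∉⇒∈∁ S i (L∩S i e)) B∩S

module FiniteSums {c ℓ} (𝕜 : Field₀ c ℓ) where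

  open Compositions using (T⇒true; true⇒T; filter-accept; filter-reject)
  open Hopf 𝕜 renaming (refl to ≈-refl; sym to ≈-sym; trans to ≈-trans)
  open import Data.Bool using (Bool; true; false; _∧_)
  open import Data.List using (List; []; _∷_; filterᵇ; map)
  open import Data.List.Membership.Propositional using (_∈_)
  open import Data.List.Membership.Propositional.Properties using (∈-map⁺; ∈-map⁻; ∈-filter⁺; ∈-filter⁻)
  open import Data.List.Membership.Propositional.Properties.WithK using (unique∧set⇒bag)
  open import Data.List.Relation.Binary.BagAndSetEquality using (∼bag⇒↭)
  open import Data.List.Relation.Binary.Permutation.Propositional using (_↭_; refl; prep; swap; trans)
  open import Data.List.Relation.Unary.Any using (here; there)
  open import Data.List.Relation.Unary.All as All using ()
  import Data.List.Relation.Unary.All.Properties as AllP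
  open import Data.List.Relation.Unary.AllPairs using ([]; _∷_)
  open import Data.List.Relation.Unary.Unique.Propositional using (Unique)
  import Data.List.Relation.Unary.Unique.Propositional.Properties as UP
  open import Data.Product using (_×_; _,_; proj₁; proj₂)
  open import Data.Empty using (⊥-elim)
  open import Relation.Nullary using (¬_; yes; no)
  open import Relation.Nullary.Decidable using (T?)
  open import Relation.Binary.Definitions using (DecidableEquality)
  import Relation.Binary.PropositionalEquality as P
  open P using (_≡_; _≢_)
  open import Function using (_∘_; mk⇔)
  open import Relation.Binary.Reasoning.Setoid setoid

  ind-true : ∀ {b} → b ≡ true → ind b ≈ 1#
  ind-true P.refl = ≈-refl

  ind-false : ∀ {b} → b ≡ false → ind b ≈ 0#
  ind-false P.refl = ≈-refl

  ind-∧ : ∀ a b → ind (a ∧ b) ≈ ind a * ind b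
  ind-∧ true b = ≈-sym (*-identityˡ _)
  ind-∧ false b = ≈-sym (zeroˡ _)

  ∑-cong : ∀ {a} {A : Set a} (xs : List A) {f g : A → Carrier} → (∀ x → x ∈ xs → f x ≈ g x) → ∑ xs f ≈ ∑ xs g
  ∑-cong [] h = ≈-refl
  ∑-cong (x ∷ xs) h = +-cong (h x (here P.refl)) (∑-cong xs (λ y m → h y (there m)))

  ∑-zero : ∀ {a} {A : Set a} (xs : List A) {f : A → Carrier} → (∀ x → x ∈ xs → f x ≈ 0#) → ∑ xs f ≈ 0#
  ∑-zero [] h = ≈-refl
  ∑-zero (x ∷ xs) h = ≈-trans (+-cong (h x (here P.refl)) (∑-zero xs (λ y m → h y (there m)))) (+-identityʳ 0#)

  ∑-+ : ∀ {a} {A : Set a} (xs : List A) (f g : A → Carrier) → ∑ xs (λ x → f x + g x) ≈ ∑ xs f + ∑ xs g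
  ∑-+ [] f g = ≈-sym (+-identityʳ 0#)
  ∑-+ (x ∷ xs) f g = begin
    (f x + g x) + ∑ xs (λ x → f x + g x) ≈⟨ +-congˡ (∑-+ xs f g) ⟩
    (f x + g x) + (∑ xs f + ∑ xs g)      ≈⟨ +-assoc _ _ _ ⟩
    f x + (g x + (∑ xs f + ∑ xs g))      ≈⟨ +-congˡ (≈-sym (+-assoc _ _ _)) ⟩
    f x + ((g x + ∑ xs f) + ∑ xs g)      ≈⟨ +-congˡ (+-congʳ (+-comm _ _)) ⟩
    f x + ((∑ xs f + g x) + ∑ xs g)      ≈⟨ +-congˡ (+-assoc _ _ _) ⟩
    f x + (∑ xs f + (g x + ∑ xs g))      ≈⟨ ≈-sym (+-assoc _ _ _) ⟩
    (f x + ∑ xs f) + (g x + ∑ xs g)      ∎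

  ∑-map : ∀ {a b} {A : Set a} {B : Set b} (h : A → B) (xs : List A) (f : B → Carrier) → ∑ (map h xs) f ≈ ∑ xs (f ∘ h)
  ∑-map h [] f = ≈-refl
  ∑-map h (x ∷ xs) f = +-congˡ (∑-map h xs f)

  ∑-perm : ∀ {a} {A : Set a} {xs ys : List A} (f : A → Carrier) → xs ↭ ys → ∑ xs f ≈ ∑ ys f
  ∑-perm f refl = ≈-refl
  ∑-perm f (prep x p) = +-congˡ (∑-perm f p)
  ∑-perm f (swap x y p) = ≈-trans (≈-sym (+-assoc _ _ _)) (≈-trans (+-congʳ (+-comm _ _))
    (≈-trans (+-assoc _ _ _) (+-congˡ (+-congˡ (∑-perm f p)))))
  ∑-perm f (trans p q) = ≈-trans (∑-perm f p) (∑-perm f q)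

  ∑-filter : ∀ {a} {A : Set a} (xs : List A) (Q : A → Bool) (f : A → Carrier) →
    ∑ xs (λ x → ind (Q x) * f x) ≈ ∑ (filterᵇ Q xs) f
  ∑-filter [] Q f = ≈-refl
  ∑-filter (x ∷ xs) Q f = by-head (Q x) P.refl
    where
    by-head : ∀ b → Q x ≡ b → ∑ (x ∷ xs) (λ x → ind (Q x) * f x) ≈ ∑ (filterᵇ Q (x ∷ xs)) f
    by-head true e rewrite filter-accept Q x xs e | e = +-cong (*-identityˡ _) (∑-filter xs Q f)
    by-head false e rewrite filter-reject Q x xs e | e =
      ≈-trans (+-congʳ (zeroˡ _)) (≈-trans (+-identityˡ _) (∑-filter xs Q f))

  ∑-single : ∀ {a} {A : Set a} (_≟_ : DecidableEquality A) (xs : List A) (h : A → Carrier) (a : A) →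
    Unique xs → a ∈ xs → (∀ x → x ∈ xs → x ≢ a → h x ≈ 0#) → ∑ xs h ≈ h a
  ∑-single _≟_ (x ∷ xs) h a (x∉ ∷ u) m z with x ≟ a
  ... | yes P.refl = ≈-trans (+-congˡ (∑-zero xs (λ y my → z y (there my) (λ { P.refl → All.lookup x∉ my P.refl }))))
                       (+-identityʳ _)
  ... | no x≢a with m
  ... | here e = ⊥-elim (x≢a (P.sym e))
  ... | there m' = ≈-trans (+-cong (z x (here P.refl) x≢a) (∑-single _≟_ xs h a u m' (λ y my → z y (there my))))
                     (+-identityˡ _)

  ∑-ind-unique : ∀ {a} {A : Set a} (_≟_ : DecidableEquality A) (xs : List A) (Q : A → Bool) (g : A → Carrier)
    (a : A) →
    Unique xs → a ∈ xs → (∀ x → x ∈ xs → Q x ≡ true → x ≡ a) →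
    ∑ xs (λ x → ind (Q x) * g x) ≈ ind (Q a) * g a
  ∑-ind-unique _≟_ xs Q g a u m only-a = ∑-single _≟_ xs (λ x → ind (Q x) * g x) a u m z
    where
    z : ∀ x → x ∈ xs → x ≢ a → ind (Q x) * g x ≈ 0#
    z x mx x≢a with Q x in e
    ... | true = ⊥-elim (x≢a (only-a x mx e))
    ... | false = zeroˡ _

  ∑-ind-none : ∀ {a} {A : Set a} (xs : List A) (Q : A → Bool) (g : A → Carrier) →
    (∀ x → x ∈ xs → Q x ≡ false) → ∑ xs (λ x → ind (Q x) * g x) ≈ 0#
  ∑-ind-none xs Q g h = ∑-zero xs (λ x m → ≈-trans (*-congʳ (ind-false (h x m))) (zeroˡ _))

  -- x + x = y + y implies x = y, since 2 ≠ 0 in characteristic zero.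
  double-injective : ∀ {x y} → x + x ≈ y + y → x ≈ y
  double-injective {x} {y} h = begin
    x                  ≈⟨ ≈-sym (*-identityˡ x) ⟩
    1# * x             ≈⟨ *-congʳ (≈-sym ½*2≈1) ⟩
    (½ * two) * x      ≈⟨ *-assoc _ _ _ ⟩
    ½ * (two * x)      ≈⟨ *-congˡ (two* x) ⟩
    ½ * (x + x)        ≈⟨ *-congˡ h ⟩
    ½ * (y + y)        ≈⟨ *-congˡ (≈-sym (two* y)) ⟩
    ½ * (two * y)      ≈⟨ ≈-sym (*-assoc _ _ _) ⟩
    (½ * two) * y      ≈⟨ *-congʳ ½*2≈1 ⟩
    1# * y             ≈⟨ *-identityˡ y ⟩
    y                  ∎
    where
    two : Carrier
    two = 1# + 1#
    two≉0 : ¬ (two ≈ 0#)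
    two≉0 h with charZero 2 (≈-trans (+-congˡ (+-identityʳ 1#)) h)
    ... | ()
    ½ : Carrier
    ½ = proj₁ (inverse two two≉0)
    ½*2≈1 : ½ * two ≈ 1#
    ½*2≈1 = ≈-trans (*-comm _ _) (proj₂ (inverse two two≉0))
    two* : ∀ z → two * z ≈ z + z
    two* z = ≈-trans (distribʳ z 1# 1#) (+-cong (*-identityˡ z) (*-identityˡ z))

  map-unique : ∀ {a} {A : Set a} (ι : A → A) (xs : List A) → Unique xs →
    (∀ {x y} → x ∈ xs → y ∈ xs → ι x ≡ ι y → x ≡ y) → Unique (map ι xs)
  map-unique ι [] _ _ = []
  map-unique ι (x ∷ xs) (x∉ ∷ u) inj =
    AllP.map⁺ (All.tabulate (λ {y} my e → All.lookup x∉ my (inj (here P.refl) (there my) e)))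
    ∷ map-unique ι xs u (λ mx my → inj (there mx) (there my))

  involution-permutes : ∀ {a} {A : Set a} (ι : A → A) (L : List A) → Unique L →
    (∀ {x} → x ∈ L → ι x ∈ L) → (∀ {x} → x ∈ L → ι (ι x) ≡ x) → L ↭ map ι L
  involution-permutes ι L u ι∈L ιι = ∼bag⇒↭ (unique∧set⇒bag u ιL-unique (mk⇔ to from))
    where
    ιL-unique : Unique (map ι L)
    ιL-unique = map-unique ι L u (λ mx my e → P.trans (P.sym (ιι mx)) (P.trans (P.cong ι e) (ιι my)))
    to : ∀ {z} → z ∈ L → z ∈ map ι L
    to {z} m = P.subst (_∈ map ι L) (ιι m) (∈-map⁺ ι (ι∈L m))
    from : ∀ {z} → z ∈ map ι L → z ∈ L
    from m with ∈-map⁻ ι m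
    ... | y , my , P.refl = ι∈L my

  -- Let ι be an involution of the terms selected by
  -- Q (a repetition-free list), reversing the sign of f off its fixed points, and
  -- whose only fixed point is a.  Then the selected terms sum to f a: pairing
  -- each term with its image, the sum Σ satisfies Σ + Σ = f a + f a.
  sign-reversing-involution : ∀ {a} {A : Set a} (_≟_ : DecidableEquality A) (xs : List A) (Q : A → Bool)
    (ι : A → A) (f : A → Carrier) (a : A) → Unique xs →
    (∀ x → x ∈ xs → Q x ≡ true → (ι x ∈ xs) × (Q (ι x) ≡ true) × (ι (ι x) ≡ x)) →
    (∀ x → x ∈ xs → Q x ≡ true → ι x ≡ x → x ≡ a) →
    (∀ x → x ∈ xs → Q x ≡ true → ι x ≢ x → f (ι x) ≈ - f x) →
    a ∈ xs → Q a ≡ true → ι a ≡ a →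
    ∑ xs (λ x → ind (Q x) * f x) ≈ f a
  sign-reversing-involution {A = A} _≟_ xs Q ι f a u involutive fixed-unique sign-reversing a∈ Qa ιa≡a =
    ≈-trans (∑-filter xs Q f) (double-injective twice)
    where
    L : List A
    L = filterᵇ Q xs
    L⁻ : ∀ {x} → x ∈ L → x ∈ xs × Q x ≡ true
    L⁻ m with ∈-filter⁻ (T? ∘ Q) {xs = xs} m
    ... | mx , t = mx , T⇒true t
    L⁺ : ∀ {x} → x ∈ xs → Q x ≡ true → x ∈ L
    L⁺ mx q = ∈-filter⁺ (T? ∘ Q) mx (true⇒T q)
    L-unique : Unique L
    L-unique = UP.filter⁺ (T? ∘ Q) u
    ι-permutes : L ↭ map ι L
    ι-permutes = involution-permutes ι L L-unique
      (λ m → let (mx , q) = L⁻ m ; (m' , q' , _) = involutive _ mx q in L⁺ m' q')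
      (λ m → let (mx , q) = L⁻ m in proj₂ (proj₂ (involutive _ mx q)))
    cancels : ∀ x → x ∈ L → x ≢ a → f x + f (ι x) ≈ 0#
    cancels x m x≢a = let (mx , q) = L⁻ m in
      ≈-trans (+-congˡ (sign-reversing x mx q (λ e → x≢a (fixed-unique x mx q e)))) (-‿inverseʳ (f x))
    twice : ∑ L f + ∑ L f ≈ f a + f a
    twice = begin
      ∑ L f + ∑ L f              ≈⟨ +-congˡ (≈-trans (∑-perm f ι-permutes) (∑-map ι L f)) ⟩
      ∑ L f + ∑ L (f ∘ ι)        ≈⟨ ≈-sym (∑-+ L f (f ∘ ι)) ⟩
      ∑ L (λ x → f x + f (ι x))  ≈⟨ ∑-single _≟_ L (λ x → f x + f (ι x)) a L-unique (L⁺ a∈ Qa) cancels ⟩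
      f a + f (ι a)              ≈⟨ +-congˡ (reflexive (P.cong f ιa≡a)) ⟩
      f a + f a                  ∎

module Quasishuffles where

  open Compositions
  open import Data.Bool using (Bool; true; false; _∧_; _∨_; not)
  import Data.Bool.Properties as BP
  open import Data.Nat using (_≤_; _+_; z≤n; s≤s)
  import Data.Nat.Properties as NP
  open import Data.Fin using (Fin)
  import Data.Vec.Properties as VP
  open import Data.Fin.Subset using (Subset; _∩_; ∁; ⊤)
  open import Data.List using ([]; _∷_; length)
  import Data.List.Properties as LP
  open import Data.List.Relation.Unary.All using (All; []; _∷_)
  open import Data.Product using (_×_; _,_)
  open import Data.Sum using (inj₁; inj₂)
  open import Data.Empty using (⊥-elim)
  open import Relation.Nullary using (yes; no)
  open import Relation.Nullary.Decidable using (⌊_⌋)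
  open import Relation.Binary.Definitions using (DecidableEquality)
  open import Relation.Binary.PropositionalEquality using (_≡_; _≢_; refl; sym; trans; cong)

  ⊆ᵣ⁻ : ∀ {n} (p q : Rel₂ n) → (p ⊆ᵣ q) ≡ true → ∀ i j → p i j ≡ true → q i j ≡ true
  ⊆ᵣ⁻ p q h i j e = imp (allFin⁻ _ (allFin⁻ _ h i) j)
    where
    imp : (not (p i j) ∨ q i j) ≡ true → q i j ≡ true
    imp x rewrite e = x

  ⊆ᵣ⁺ : ∀ {n} (p q : Rel₂ n) → (∀ i j → p i j ≡ true → q i j ≡ true) → (p ⊆ᵣ q) ≡ true
  ⊆ᵣ⁺ p q h = allFin⁺ _ (λ i → allFin⁺ _ (λ j → imp i j (p i j) refl))
    where
    imp : ∀ i j b → p i j ≡ b → (not (p i j) ∨ q i j) ≡ true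
    imp i j true e rewrite e = h i j e
    imp i j false e rewrite e = refl

  -- The decision procedure behind Hopf._≟_ᶜ (which is ⌊ decComp F G ⌋ by definition).
  decComp : ∀ {n} → DecidableEquality (Comp n)
  decComp = LP.≡-dec (VP.≡-dec BP._≟_)

  decComp-refl : ∀ {n} (X : Comp n) → ⌊ decComp X X ⌋ ≡ true
  decComp-refl X with decComp X X
  ... | yes _ = refl
  ... | no X≢X = ⊥-elim (X≢X refl)

  decComp-true : ∀ {n} (X Y : Comp n) → ⌊ decComp X Y ⌋ ≡ true → X ≡ Y
  decComp-true X Y e with decComp X Y
  ... | yes X≡Y = X≡Y

  decComp-false : ∀ {n} (X Y : Comp n) → X ≢ Y → ⌊ decComp X Y ⌋ ≡ false
  decComp-false X Y X≢Y with decComp X Y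
  ... | yes X≡Y = ⊥-elim (X≢Y X≡Y)
  ... | no _ = refl

  decComp-≡ : ∀ {n} {X Y : Comp n} → X ≡ Y → ⌊ decComp X Y ⌋ ≡ true
  decComp-≡ {X = X} refl = decComp-refl X

  restrict-mono : ∀ {n} (H K : Comp n) V → (∀ i j → rel H i j ≡ true → rel K i j ≡ true) →
    ∀ i j → rel (restrict H V) i j ≡ true → rel (restrict K V) i j ≡ true
  restrict-mono H K V H≤K i j r = trans (rel-restrict K V i j) (∧I iV (∧I jV (H≤K i j rH)))
    where
    r' : (i ∈ᵇ V ∧ (j ∈ᵇ V ∧ rel H i j)) ≡ true
    r' = trans (sym (rel-restrict H V i j)) r
    iV : i ∈ᵇ V ≡ true
    iV = ∧T₁ r'
    jV : j ∈ᵇ V ≡ true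
    jV = ∧T₁ (∧T₂ {i ∈ᵇ V} r')
    rH : rel H i j ≡ true
    rH = ∧T₂ {j ∈ᵇ V} (∧T₂ {i ∈ᵇ V} r')

  same-restriction : ∀ {n} (H₁ H₂ : Comp n) V i j → restrict H₁ V ≡ restrict H₂ V →
    i ∈ᵇ V ≡ true → j ∈ᵇ V ≡ true → rel H₁ i j ≡ true → rel H₂ i j ≡ true
  same-restriction H₁ H₂ V i j eq iV jV r =
    ∧T₂ {j ∈ᵇ V} (∧T₂ {i ∈ᵇ V} (trans (sym (rel-restrict H₂ V i j))
      (trans (cong (λ Z → rel Z i j) (sym eq)) (trans (rel-restrict H₁ V i j) (∧I iV (∧I jV r))))))

  misses-S⇒meets-∁S : ∀ {n} (S X : Subset n) → NonEmpty X → nonemptyᵇ (S ∩ X) ≡ false → nonemptyᵇ (∁ S ∩ X) ≡ true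
  misses-S⇒meets-∁S S X (x₀ , x₀∈X) e =
    nonemptyᵇ⁺ (∁ S ∩ X) (x₀ , trans (∈∩ (∁ S) X x₀) (∧I (∉⇒∈∁ S x₀ (empty∩⇒∉ˡ S X e x₀ x₀∈X)) x₀∈X))

  -- Every lump meets S or ∁ S, so H has at most l(H|S) + l(H|∁S) lumps.
  length-≤-restrictions : ∀ {n} (S : Subset n) H → All NonEmpty H →
    length H ≤ length (restrict H S) + length (restrict H (∁ S))
  length-≤-restrictions S [] _ = z≤n
  length-≤-restrictions S (X ∷ H) (neX ∷ ne) with nonemptyᵇ (S ∩ X) in eS
  ... | true = s≤s (NP.≤-trans ih (NP.+-monoʳ-≤ (length (restrict H S)) (T-part-grows H)))
    where
    ih = length-≤-restrictions S H ne
    T-part-grows : ∀ H → length (restrict H (∁ S)) ≤ length (restrict (X ∷ H) (∁ S))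
    T-part-grows H rewrite restrict-∷ X H (∁ S) with nonemptyᵇ (∁ S ∩ X)
    ... | true = NP.n≤1+n _
    ... | false = NP.≤-refl
  ... | false rewrite restrict-keep X H (∁ S) (misses-S⇒meets-∁S S X neX eS) =
    NP.≤-trans (s≤s (length-≤-restrictions S H ne)) (NP.≤-reflexive (sym (NP.+-suc _ _)))

  module _ {n} (S : Subset n) (F G : Comp n) (cF : CompOf S F) (cG : CompOf (∁ S) G) where

    F∣G : Rel₂ n
    F∣G = F ∣∣ G

    F∣G-on-S : ∀ i j → i ∈ᵇ S ≡ true → rel F i j ≡ F∣G i j
    F∣G-on-S i j iS = sym (trans (cong (rel F i j ∨_)
      (uncovered⇒¬rel₁ G i j (trans (CompOf-covers (∁ S) G cG i) (∈⇒∉∁ S i iS)))) (BP.∨-identityʳ _))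

    F∣G-on-∁S : ∀ i j → i ∈ᵇ ∁ S ≡ true → rel G i j ≡ F∣G i j
    F∣G-on-∁S i j iT = sym (cong (_∨ rel G i j)
        (uncovered⇒¬rel₁ F i j (trans (CompOf-covers S F cF i) (∈∁⇒∉ S i iT))))

    restriction-of-quasishuffle : ∀ (H X : Comp n) V → CompOf V X →
      (∀ i j → i ∈ᵇ V ≡ true → rel X i j ≡ F∣G i j) →
      (∀ i j → F∣G i j ≡ true → rel H i j ≡ true) →
      (∀ i j → F∣G i j ≡ true → F∣G j i ≡ false → rel H j i ≡ false) →
      ∀ i j → rel X i j ≡ rel (restrict H V) i j
    restriction-of-quasishuffle H X V cX X≡F∣G F∣G⊆H strict-kept i j =
      trans (by-membership (i ∈ᵇ V) refl (j ∈ᵇ V) refl) (sym (rel-restrict H V i j))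
      where
      by-membership : ∀ b → i ∈ᵇ V ≡ b → ∀ b' → j ∈ᵇ V ≡ b' → rel X i j ≡ (i ∈ᵇ V ∧ (j ∈ᵇ V ∧ rel H i j))
      by-membership false iV _ _ rewrite iV = uncovered⇒¬rel₁ X i j (trans (CompOf-covers V X cX i) iV)
      by-membership true iV false jV rewrite iV | jV = uncovered⇒¬rel₂ X i j (trans (CompOf-covers V X cX j) jV)
      by-membership true iV true jV rewrite iV | jV = ⇔⇒≡ (λ r → F∣G⊆H i j (trans (sym (X≡F∣G i j iV)) r)) back
        where
        -- X is total on V, so a pair missing from X is strict the other way
        back : rel H i j ≡ true → rel X i j ≡ true
        back rH with rel X i j in eX
        ... | true = refl
        ... | false with rel-total X i j (trans (CompOf-covers V X cX i) iV) (trans (CompOf-covers V X cX j) jV)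
        ... | inj₁ r = ⊥-elim (false≢true (trans (sym eX) r))
        ... | inj₂ r = ⊥-elim (false≢true (trans (sym (strict-kept j i (trans (sym (X≡F∣G j i jV)) r)
                         (trans (sym (X≡F∣G i j iV)) eX))) rH))

    quasishuffle⇒restrictions : ∀ H → CompOf ⊤ H → (rel H ≼ₚ F∣G) ≡ true →
      (restrict H S ≡ F) × (restrict H (∁ S) ≡ G)
    quasishuffle⇒restrictions H cH e =
      sym (rel-injective S F (restrict H S) cF (CompOf-restrict-⊤ H S cH)
        (restriction-of-quasishuffle H F S cF F∣G-on-S F∣G⊆H strict-kept)) ,
      sym (rel-injective (∁ S) G (restrict H (∁ S)) cG (CompOf-restrict-⊤ H (∁ S) cH)
        (restriction-of-quasishuffle H G (∁ S) cG F∣G-on-∁S F∣G⊆H strict-kept))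
      where
      F∣G⊆H : ∀ i j → F∣G i j ≡ true → rel H i j ≡ true
      F∣G⊆H = ⊆ᵣ⁻ F∣G (rel H) (∧T₁ e)
      strict-kept : ∀ i j → F∣G i j ≡ true → F∣G j i ≡ false → rel H j i ≡ false
      strict-kept i j r nr = not-true (∧T₂ {rel H i j} (⊆ᵣ⁻ (strict F∣G) (strict (rel H)) (∧T₂ {F∣G ⊆ᵣ rel H} e) i j
                               (∧I r (cong not nr))))

    restrictions⇒quasishuffle : ∀ H → restrict H S ≡ F → restrict H (∁ S) ≡ G → (rel H ≼ₚ F∣G) ≡ true
    restrictions⇒quasishuffle H eF eG = ∧I (⊆ᵣ⁺ F∣G (rel H) F∣G⊆H) (⊆ᵣ⁺ (strict F∣G) (strict (rel H)) strict-kept)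
      where
      F-via-H : ∀ i j → rel F i j ≡ (i ∈ᵇ S ∧ (j ∈ᵇ S ∧ rel H i j))
      F-via-H i j = trans (cong (λ Z → rel Z i j) (sym eF)) (rel-restrict H S i j)
      G-via-H : ∀ i j → rel G i j ≡ (i ∈ᵇ ∁ S ∧ (j ∈ᵇ ∁ S ∧ rel H i j))
      G-via-H i j = trans (cong (λ Z → rel Z i j) (sym eG)) (rel-restrict H (∁ S) i j)
      F∣G⊆H : ∀ i j → F∣G i j ≡ true → rel H i j ≡ true
      F∣G⊆H i j r with ∨E {rel F i j} r
      ... | inj₁ a = ∧T₂ {j ∈ᵇ S} (∧T₂ {i ∈ᵇ S} (trans (sym (F-via-H i j)) a))
      ... | inj₂ a = ∧T₂ {j ∈ᵇ ∁ S} (∧T₂ {i ∈ᵇ ∁ S} (trans (sym (G-via-H i j)) a))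
      -- a pair (i, j) inside V with j ≤ i in H would give j ≤ i in (F|G)
      reverse-in : ∀ V X → (∀ i j → rel X i j ≡ (i ∈ᵇ V ∧ (j ∈ᵇ V ∧ rel H i j))) → ∀ i j →
        rel X i j ≡ true → rel H j i ≡ true → rel X j i ≡ true
      reverse-in V X via i j a rji = trans (via j i) (∧I jV (∧I iV rji))
        where
        a' : (i ∈ᵇ V ∧ (j ∈ᵇ V ∧ rel H i j)) ≡ true
        a' = trans (sym (via i j)) a
        iV : i ∈ᵇ V ≡ true
        iV = ∧T₁ a'
        jV : j ∈ᵇ V ≡ true
        jV = ∧T₁ (∧T₂ {i ∈ᵇ V} a')
      strict-kept : ∀ i j → strict F∣G i j ≡ true → strict (rel H) i j ≡ true
      strict-kept i j r = ∧I (F∣G⊆H i j (∧T₁ r)) (cong not (≢true⇒false H-not-back))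
        where
        ¬F∣G-back : F∣G j i ≡ false
        ¬F∣G-back = not-true (∧T₂ {F∣G i j} r)
        H-not-back : rel H j i ≢ true
        H-not-back rji with ∨E {rel F i j} (∧T₁ r)
        ... | inj₁ a = false≢true (trans (sym (∨-false₁ (rel F j i) ¬F∣G-back)) (reverse-in S F F-via-H i j a rji))
        ... | inj₂ a = false≢true (trans (sym (∨-false₂ (rel F j i) ¬F∣G-back))
            (reverse-in (∁ S) G G-via-H i j a rji))

    quasishuffle≡restrictions : ∀ H → CompOf ⊤ H →
      (rel H ≼ₚ F∣G) ≡ (⌊ decComp (restrict H S) F ⌋ ∧ ⌊ decComp (restrict H (∁ S)) G ⌋)
    quasishuffle≡restrictions H cH = ⇔⇒≡
      (λ e → let (eF , eG) = quasishuffle⇒restrictions H cH e in ∧I (decComp-≡ eF) (decComp-≡ eG))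
      (λ e → restrictions⇒quasishuffle H (decComp-true _ _ (∧T₁ e))
          (decComp-true _ _ (∧T₂ {⌊ decComp (restrict H S) F ⌋} e)))

module Concatenation {n} (S : Subset n) (F′ G′ : Comp n)
  (cF : Compositions.CompOf S F′) (cG : Compositions.CompOf (∁ S) G′) where

  open Compositions
  open InitialSegments
  open Quasishuffles using (⊆ᵣ⁻; ⊆ᵣ⁺)
  open import Data.Bool using (Bool; true; false; _∧_; _∨_; not)
  import Data.Bool.Properties as BP
  open import Data.Nat using (_≤_)
  import Data.Nat.Properties as NP
  open import Data.Fin.Subset using (Subset; ∁; ⊤)
  open import Data.List using (List; []; _∷_; length; take; _++_)
  import Data.List.Properties as LP
  open import Data.List.Relation.Unary.All as All using (All)
  open import Data.Product using (_,_; proj₁; proj₂)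
  open import Data.Empty using (⊥-elim)
  open import Relation.Binary.PropositionalEquality using (_≡_; refl; sym; trans; cong; cong₂; subst)

  F′G′ : Comp n
  F′G′ = F′ ++ G′

  covers-F′ : ∀ i → covers F′ i ≡ i ∈ᵇ S
  covers-F′ = CompOf-covers S F′ cF

  covers-G′ : ∀ i → covers G′ i ≡ not (i ∈ᵇ S)
  covers-G′ i = trans (CompOf-covers (∁ S) G′ cG i) (∈∁ S i)

  F′G′-CompOf : CompOf ⊤ F′G′
  F′G′-CompOf = CompOf-cong F′G′ (∈S∪∁S S) (CompOf-++ S (∁ S) F′ G′ cF cG (S∩∁S-empty S))

  F′G′-restrict-S : restrict F′G′ S ≡ F′
  F′G′-restrict-S = restrict-++ˡ S F′ G′ cF
    (All.map (λ G′⊆∁S i e → ∈∁⇒∉ S i (G′⊆∁S i e)) (CompOf-lumps (∁ S) G′ cG))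

  F′G′-restrict-∁S : restrict F′G′ (∁ S) ≡ G′
  F′G′-restrict-∁S = restrict-++ʳ (∁ S) F′ G′
    (All.map (λ F′⊆S i e → ∈⇒∉∁ S i (F′⊆S i e)) (CompOf-lumps S F′ cF)) cG

  F′G′-initial : isInitial S F′G′ ≡ true
  F′G′-initial = isInitial⁺ S F′G′ (length F′) (subst (length F′ ≤_) (sym (LP.length-++ F′)) (NP.m≤m+n _ _))
    (λ i → sym (trans (cong (λ Z → covers Z i) (take-length-++ F′ G′)) (covers-F′ i)))
    where
    take-length-++ : ∀ {a} {A : Set a} (xs ys : List A) → take (length xs) (xs ++ ys) ≡ xs
    take-length-++ [] ys = refl
    take-length-++ (x ∷ xs) ys = cong (x ∷_) (take-length-++ xs ys)

  rel-F′G′-from-S : ∀ i j → i ∈ᵇ S ≡ true → rel F′G′ i j ≡ (rel F′ i j ∨ not (j ∈ᵇ S))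
  rel-F′G′-from-S i j e = trans (rel-++-prefix F′ G′ i j G′⇒¬F′ (trans (covers-F′ i) e))
      (cong (rel F′ i j ∨_) (covers-G′ j))
    where
    G′⇒¬F′ : ∀ k → covers G′ k ≡ true → covers F′ k ≡ false
    G′⇒¬F′ k e = trans (covers-F′ k) (not-true (trans (sym (covers-G′ k)) e))

  rel-F′G′-from-∁S : ∀ i j → i ∈ᵇ S ≡ false → rel F′G′ i j ≡ (not (j ∈ᵇ S) ∧ rel G′ i j)
  rel-F′G′-from-∁S i j e = trans (rel-++-suffix F′ G′ i j (trans (covers-F′ i) e))
                            (cong (λ b → not b ∧ rel G′ i j) (covers-F′ j))

  F′G′-unique : ∀ K₂ → CompOf ⊤ K₂ → isInitial S K₂ ≡ true → restrict K₂ S ≡ F′ → restrict K₂ (∁ S) ≡ G′ → K₂ ≡ F′G′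
  F′G′-unique K₂ c init eF eG =
    trans (sym (LP.take++drop≡id m K₂)) (cong₂ _++_ (trans (sym (proj₁ split)) eF) (trans (sym (proj₂ split)) eG))
    where
    m = proj₁ (isInitial⁻ S K₂ init)
    split = restrict-prefix S K₂ m c (proj₂ (isInitial⁻ S K₂ init))

  ConeCondition : Comp n → Bool
  ConeCondition K = isInitial S K ∧ ((rel (restrict K S) ⊆ᵣ rel F′) ∧ (rel (restrict K (∁ S)) ⊆ᵣ rel G′))

  below-F′G′⇒cone : ∀ K → CompOf ⊤ K → (rel K ⊆ᵣ rel F′G′) ≡ true → ConeCondition K ≡ true
  below-F′G′⇒cone K cK h = ∧I K-initial (∧I (⊆ᵣ⁺ _ _ on-S) (⊆ᵣ⁺ _ _ on-∁S))
    where
    K⊆F′G′ = ⊆ᵣ⁻ (rel K) (rel F′G′) h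
    -- in F′G′ nothing of ∁ S precedes S, hence neither in K
    no-backward : NoBackward ⊤ K S
    no-backward i j _ iS jS = ≢true⇒false λ r → false≢true
      (trans (sym (trans (rel-F′G′-from-∁S i j iS) (cong (λ b → not b ∧ rel G′ i j) jS))) (K⊆F′G′ i j r))
    K-initial : isInitial S K ≡ true
    K-initial = let (m , le , eq) = no-backward⇒prefix ⊤ K S cK no-backward in
      isInitial⁺ S K m le (λ i → trans (sym (trans (cong (i ∈ᵇ S ∧_) (∈⊤ i)) (BP.∧-identityʳ _))) (eq i))
    on-S : ∀ i j → rel (restrict K S) i j ≡ true → rel F′ i j ≡ true
    on-S i j e = trans (sym (BP.∨-identityʳ _))
      (subst (λ b → (rel F′ i j ∨ not b) ≡ true) jS (trans (sym (rel-F′G′-from-S i j iS)) (K⊆F′G′ i j rK)))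
      where
      e' = trans (sym (rel-restrict K S i j)) e
      iS = ∧T₁ e'
      jS = ∧T₁ (∧T₂ {i ∈ᵇ S} e')
      rK = ∧T₂ {j ∈ᵇ S} (∧T₂ {i ∈ᵇ S} e')
    on-∁S : ∀ i j → rel (restrict K (∁ S)) i j ≡ true → rel G′ i j ≡ true
    on-∁S i j e = ∧T₂ {not (j ∈ᵇ S)} (trans (sym (rel-F′G′-from-∁S i j iS)) (K⊆F′G′ i j rK))
      where
      e' = trans (sym (rel-restrict K (∁ S) i j)) e
      iS = ∈∁⇒∉ S i (∧T₁ e')
      rK = ∧T₂ {j ∈ᵇ ∁ S} (∧T₂ {i ∈ᵇ ∁ S} e')

  cone⇒below-F′G′ : ∀ K → ConeCondition K ≡ true → (rel K ⊆ᵣ rel F′G′) ≡ true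
  cone⇒below-F′G′ K cone = ⊆ᵣ⁺ _ _ λ i j e → by-sides i j e (i ∈ᵇ S) refl (j ∈ᵇ S) refl
    where
    prefix = isInitial⁻ S K (∧T₁ cone)
    rest = ∧T₂ {isInitial S K} cone
    K|S⊆F′ = ⊆ᵣ⁻ _ _ (∧T₁ rest)
    K|∁S⊆G′ = ⊆ᵣ⁻ _ _ (∧T₂ {rel (restrict K S) ⊆ᵣ rel F′} rest)
    by-sides : ∀ i j → rel K i j ≡ true → ∀ b → i ∈ᵇ S ≡ b → ∀ b' → j ∈ᵇ S ≡ b' → rel F′G′ i j ≡ true
    by-sides i j e true iS true jS =
      trans (rel-F′G′-from-S i j iS) (∨I₁ (K|S⊆F′ i j (trans (rel-restrict K S i j) (∧I iS (∧I jS e)))))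
    by-sides i j e true iS false jS = trans (rel-F′G′-from-S i j iS) (∨I₂ {rel F′ i j} (cong not jS))
    by-sides i j e false iS true jS = ⊥-elim (false≢true (trans (sym (prefix-no-backward (proj₁ prefix) K i j
      (trans (sym (proj₂ prefix i)) iS) (trans (sym (proj₂ prefix j)) jS))) e))
    by-sides i j e false iS false jS = trans (rel-F′G′-from-∁S i j iS) (∧I (cong not jS)
      (K|∁S⊆G′ i j (trans (rel-restrict K (∁ S) i j) (∧I (∉⇒∈∁ S i iS) (∧I (∉⇒∈∁ S j jS) e)))))

  below-F′G′≡cone : ∀ K → CompOf ⊤ K → (rel K ⊆ᵣ rel F′G′) ≡ ConeCondition K
  below-F′G′≡cone K cK = ⇔⇒≡ (below-F′G′⇒cone K cK) (cone⇒below-F′G′ K)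

module Coproduct {c ℓ} (𝕜 : Field₀ c ℓ) where

  open Compositions using (CompOf; ∧T₁; ∧T₂)
  open Enumeration using (comps-unique; CompOf⇒∈comps; ∈comps⇒CompOf)
  open Quasishuffles using (decComp; decComp-true; decComp-≡)
  open FiniteSums 𝕜
  open Hopf 𝕜 renaming (sym to ≈-sym; trans to ≈-trans)
  open import Data.Bool using (Bool; true; false; _∧_)
  import Data.Bool.Properties as BP
  open import Data.Fin.Subset using (Subset; ∁; ⊤)
  open import Data.List.Membership.Propositional using (_∈_)
  open import Relation.Binary.PropositionalEquality as P using (_≡_)
  open import Relation.Binary.Reasoning.Setoid setoid

  module _ {n} (S : Subset n) (K : Comp n) (cK : CompOf ⊤ K) (F′ G′ : Comp n) (cF : CompOf S F′)
      (cG : CompOf (∁ S) G′) where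

    open Concatenation S F′ G′ cF cG

    SplitsInto : Comp n → Bool
    SplitsInto K₂ = isInitial S K₂ ∧ ((restrict K₂ S ≟ᶜ F′) ∧ (restrict K₂ (∁ S) ≟ᶜ G′))

    ΔM-value : ∀ K₂ → ΔM S K₂ F′ G′ ≈ ind (SplitsInto K₂)
    ΔM-value K₂ with isInitial S K₂
    ... | true = ≈-sym (ind-∧ _ _)
    ... | false = zeroˡ 0#

    Contributes : Comp n → Bool
    Contributes K₂ = (rel K ⊆ᵣ rel K₂) ∧ SplitsInto K₂

    Δ-term : ∀ K₂ → C K K₂ * ΔM S K₂ F′ G′ ≈ ind (Contributes K₂) * 1#
    Δ-term K₂ = ≈-trans (*-congˡ (ΔM-value K₂)) (≈-trans (≈-sym (ind-∧ _ _)) (≈-sym (*-identityʳ _)))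

    only-F′G′ : ∀ K₂ → K₂ ∈ comps ⊤ → Contributes K₂ ≡ true → K₂ ≡ F′G′
    only-F′G′ K₂ m q = F′G′-unique K₂ (∈comps⇒CompOf ⊤ m) (∧T₁ split) (decComp-true _ _ (∧T₁ parts))
                         (decComp-true _ _ (∧T₂ {restrict K₂ S ≟ᶜ F′} parts))
      where
      split = ∧T₂ {rel K ⊆ᵣ rel K₂} q
      parts = ∧T₂ {isInitial S K₂} split

    F′G′-contributes : Contributes F′G′ ≡ (rel K ⊆ᵣ rel F′G′)
    F′G′-contributes rewrite F′G′-initial | decComp-≡ F′G′-restrict-S | decComp-≡ F′G′-restrict-∁S = BP.∧-identityʳ _

    Cat-value : (CatS S K ⊗ CatT S K) F′ G′ ≈ ind (ConeCondition K)
    Cat-value with isInitial S K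
    ... | true = ≈-sym (ind-∧ _ _)
    ... | false = zeroˡ 0#

    Δ-sum : ∑ (comps ⊤) (λ K₂ → ind (Contributes K₂) * 1#) ≈ ind (Contributes F′G′) * 1#
    Δ-sum = ∑-ind-unique decComp (comps ⊤) Contributes (λ _ → 1#) F′G′ (comps-unique ⊤)
              (CompOf⇒∈comps ⊤ F′G′ F′G′-CompOf) only-F′G′

    coproduct-formula : Δ S (C K) F′ G′ ≈ (CatS S K ⊗ CatT S K) F′ G′
    coproduct-formula = begin
      Δ S (C K) F′ G′                                  ≈⟨ ∑-cong (comps ⊤) (λ K₂ _ → Δ-term K₂) ⟩
      ∑ (comps ⊤) (λ K₂ → ind (Contributes K₂) * 1#)  ≈⟨ Δ-sum ⟩
      ind (Contributes F′G′) * 1#                      ≈⟨ *-identityʳ _ ⟩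
      ind (Contributes F′G′)                           ≈⟨ reflexive (P.cong ind F′G′-contributes) ⟩
      ind (rel K ⊆ᵣ rel F′G′)                          ≈⟨ reflexive (P.cong ind (below-F′G′≡cone K cK)) ⟩
      ind (ConeCondition K)                            ≈⟨ ≈-sym Cat-value ⟩
      (CatS S K ⊗ CatT S K) F′ G′                      ∎

module Involution {n : ℕ} (S : Subset n) (K : Comp n) (cK : Compositions.CompOf ⊤ K) where

  open Compositions
  open Merging using (merge; merge-member; merge-head)
  open InitialSegments using (covers⁻; covers⁺)
  open Quasishuffles using (⊆ᵣ⁻; ⊆ᵣ⁺; same-restriction)
  open import Data.Bool using (Bool; true; false; _∧_; _∨_; not; if_then_else_)
  import Data.Bool.Properties as BP
  open import Data.Nat using (suc; _≤_; _<_; _≤ᵇ_)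
  import Data.Nat.Properties as NP
  open import Data.Fin using (Fin)
  open import Data.Fin.Subset using (_∩_; _∪_; _─_; ∁)
  open import Data.List using (List; []; _∷_; allFin; length)
  import Data.List.Properties as LP
  open import Data.Bool.ListAction using (all)
  open import Data.List.Membership.Propositional using (_∈_)
  open import Data.List.Relation.Unary.Any using (here; there)
  open import Data.List.Relation.Unary.All as All using (All; []; _∷_)
  open import Data.Maybe using (just; nothing)
  open import Data.Product using (∃; _×_; _,_; proj₁; proj₂)
  open import Data.Sum using (_⊎_; inj₁; inj₂)
  open import Data.Unit using () renaming (⊤ to Unit; tt to unit)
  open import Data.Empty using (⊥; ⊥-elim)
  open import Relation.Binary.PropositionalEquality using (_≡_; refl; sym; trans; cong; cong₂; subst)
  open import Function using (_∘_)

  κ : Fin n → ℕ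
  κ i with pos K i
  ... | just a = a
  ... | nothing = 0

  pos-K : ∀ i → pos K i ≡ just (κ i)
  pos-K i with pos K i | trans (sym (covers-via-pos K i)) (trans (CompOf-covers ⊤ K cK i) (∈⊤ i))
  ... | just a | _ = refl
  ... | nothing | ()

  rel-K-κ : ∀ i j → rel K i j ≡ (κ i ≤ᵇ κ j)
  rel-K-κ i j rewrite rel-via-pos K i j | pos-K i | pos-K j = refl

  rel-K⇒κ≤ : ∀ i j → rel K i j ≡ true → κ i ≤ κ j
  rel-K⇒κ≤ i j e = ≤ᵇtrue⇒≤ (trans (sym (rel-K-κ i j)) e)

  κ≤⇒rel-K : ∀ i j → κ i ≤ κ j → rel K i j ≡ true
  κ≤⇒rel-K i j le = trans (rel-K-κ i j) (≤⇒≤ᵇtrue le)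

  record Le (X Y : Subset n) : Set where
    constructor mkLe
    field le : ∀ x y → x ∈ᵇ X ≡ true → y ∈ᵇ Y ≡ true → κ x ≤ κ y
  open Le public

  -- H refines K: each lump lies in one block of K, and the lumps follow the blocks.
  Refines : Comp n → Set
  Refines [] = Unit
  Refines (X ∷ H) = Le X X × All (Le X) H × Refines H

  Refines⇒κ-mono : ∀ H → Refines H → ∀ i j → rel H i j ≡ true → κ i ≤ κ j
  Refines⇒κ-mono (X ∷ H) (X≤X , X≤H , H-refines) i j e = by-first-lump (i ∈ᵇ X) refl
    where
    by-first-lump : ∀ b → i ∈ᵇ X ≡ b → κ i ≤ κ j
    by-first-lump true ei with ∨E {j ∈ᵇ X} (trans (sym (rel-∷-in X H i j ei)) e)
    ... | inj₁ ej = le X≤X i j ei ej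
    ... | inj₂ c with covers⁻ H j c
    ... | Y , mY , ej = le (All.lookup X≤H mY) i j ei ej
    by-first-lump false ei = Refines⇒κ-mono H H-refines i j
        (∧T₂ {not (j ∈ᵇ X)} (trans (sym (rel-∷-out X H i j ei)) e))

  κ-mono⇒Refines : ∀ U H → CompOf U H → (∀ i j → rel H i j ≡ true → κ i ≤ κ j) → Refines H
  κ-mono⇒Refines U [] c h = unit
  κ-mono⇒Refines U (X ∷ H) (ne , sub , c) h =
    mkLe (λ x y ex ey → h x y (trans (rel-∷-in X H x y ex) (∨I₁ ey))) ,
    All.tabulate (λ {Y} mY → mkLe λ x y ex ey → h x y
        (trans (rel-∷-in X H x y ex) (∨I₂ {y ∈ᵇ X} (covers⁺ H y mY ey)))) ,
    κ-mono⇒Refines (U ─ X) H c (λ i j e → h i j (trans (rel-∷-out X H i j (∉X i (rel⇒covers₁ H i j e)))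
       (trans (cong (λ b → not b ∧ rel H i j) (∉X j (rel⇒covers₂ H i j e))) e)))
    where
    ∉X : ∀ k → covers H k ≡ true → k ∈ᵇ X ≡ false
    ∉X k e = ≢true⇒false λ k∈X → false≢true (trans (sym (first-lump-not-covered U X H c k k∈X)) e)

  ⊆K⇒Refines : ∀ U H → CompOf U H → (rel H ⊆ᵣ rel K) ≡ true → Refines H
  ⊆K⇒Refines U H c e = κ-mono⇒Refines U H c (λ i j r → rel-K⇒κ≤ i j (⊆ᵣ⁻ (rel H) (rel K) e i j r))

  Refines⇒⊆K : ∀ H → Refines H → (rel H ⊆ᵣ rel K) ≡ true
  Refines⇒⊆K H r = ⊆ᵣ⁺ (rel H) (rel K) (λ i j e → κ≤⇒rel-K i j (Refines⇒κ-mono H r i j e))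

  Refines-Le-self : ∀ H → Refines H → All (λ X → Le X X) H
  Refines-Le-self [] _ = []
  Refines-Le-self (X ∷ H) (X≤X , _ , H-refines) = X≤X ∷ Refines-Le-self H H-refines

  leᵇ : Subset n → Subset n → Bool
  leᵇ Y X = all (λ y → all (λ x → (y ∈ᵇ Y ∧ x ∈ᵇ X) ⇒ᵇ (κ y ≤ᵇ κ x)) (allFin n)) (allFin n)

  leᵇ⇒Le : ∀ Y X → leᵇ Y X ≡ true → Le Y X
  leᵇ⇒Le Y X e = mkLe λ y x ey ex → ≤ᵇtrue⇒≤ (imp y x ey ex (allFin⁻ _ (allFin⁻ _ e y) x))
    where
    imp : ∀ y x → y ∈ᵇ Y ≡ true → x ∈ᵇ X ≡ true → (not (y ∈ᵇ Y ∧ x ∈ᵇ X) ∨ (κ y ≤ᵇ κ x)) ≡ true → (κ y ≤ᵇ κ x) ≡ true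
    imp y x ey ex h rewrite ey | ex = h

  Le⇒leᵇ : ∀ Y X → Le Y X → leᵇ Y X ≡ true
  Le⇒leᵇ Y X h = allFin⁺ _ (λ y → allFin⁺ _ (λ x → imp y x (y ∈ᵇ Y) refl (x ∈ᵇ X) refl))
    where
    imp : ∀ y x b → y ∈ᵇ Y ≡ b → ∀ b' → x ∈ᵇ X ≡ b' → (not (y ∈ᵇ Y ∧ x ∈ᵇ X) ∨ (κ y ≤ᵇ κ x)) ≡ true
    imp y x true ey true ex rewrite ey | ex = ≤⇒≤ᵇtrue (le h y x ey ex)
    imp y x true ey false ex rewrite ey | ex = refl
    imp y x false ey b' ex rewrite ey = refl

  meetsS meetsT mixed : Subset n → Bool
  meetsS X = nonemptyᵇ (S ∩ X)
  meetsT X = nonemptyᵇ (∁ S ∩ X)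
  mixed X = meetsS X ∧ meetsT X

  mergeable : Subset n → Subset n → Bool
  mergeable X Y = not (meetsS X) ∧ (not (meetsT Y) ∧ leᵇ Y X)

  splitLump : Subset n → Comp n → Comp n
  splitLump X R = (∁ S ∩ X) ∷ (S ∩ X) ∷ R

  ι : Comp n → Comp n
  ι [] = []
  ι (X ∷ []) = if mixed X then splitLump X [] else X ∷ []
  ι (X ∷ Y ∷ R) = if mixed X then splitLump X (Y ∷ R) else (if mergeable X Y then (X ∪ Y) ∷ R else X ∷ ι (Y ∷ R))

  ι-mixed : ∀ X R → mixed X ≡ true → ι (X ∷ R) ≡ splitLump X R
  ι-mixed X [] e rewrite e = refl
  ι-mixed X (Y ∷ R) e rewrite e = refl

  ι-last : ∀ X → mixed X ≡ false → ι (X ∷ []) ≡ X ∷ []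
  ι-last X e rewrite e = refl

  ι-merge : ∀ X Y R → mixed X ≡ false → mergeable X Y ≡ true → ι (X ∷ Y ∷ R) ≡ (X ∪ Y) ∷ R
  ι-merge X Y R e e' rewrite e | e' = refl

  ι-skip : ∀ X Y R → mixed X ≡ false → mergeable X Y ≡ false → ι (X ∷ Y ∷ R) ≡ X ∷ ι (Y ∷ R)
  ι-skip X Y R e e' rewrite e | e' = refl

  ι-elim : (P : Comp n → Set) → P [] →
    (∀ X R → mixed X ≡ true → P (X ∷ R)) →
    (∀ X → mixed X ≡ false → P (X ∷ [])) →
    (∀ X Y R → mixed X ≡ false → mergeable X Y ≡ true → P (X ∷ Y ∷ R)) →
    (∀ X Y R → mixed X ≡ false → mergeable X Y ≡ false → P (Y ∷ R) → P (X ∷ Y ∷ R)) →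
    ∀ H → P H
  ι-elim P p[] p-mixed p-last p-merge p-skip [] = p[]
  ι-elim P p[] p-mixed p-last p-merge p-skip (X ∷ []) = by-cases (mixed X) refl
    where
    by-cases : ∀ b → mixed X ≡ b → P (X ∷ [])
    by-cases true e = p-mixed X [] e
    by-cases false e = p-last X e
  ι-elim P p[] p-mixed p-last p-merge p-skip (X ∷ Y ∷ R) =
    by-cases (mixed X) refl (mergeable X Y) refl (ι-elim P p[] p-mixed p-last p-merge p-skip (Y ∷ R))
    where
    by-cases : ∀ b → mixed X ≡ b → ∀ b' → mergeable X Y ≡ b' → P (Y ∷ R) → P (X ∷ Y ∷ R)
    by-cases true e _ _ _ = p-mixed X (Y ∷ R) e
    by-cases false e true c _ = p-merge X Y R e c
    by-cases false e false c ih = p-skip X Y R e c ih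

  mixed⇒meetsS : ∀ X → mixed X ≡ true → meetsS X ≡ true
  mixed⇒meetsS X e = ∧T₁ e

  mixed⇒meetsT : ∀ X → mixed X ≡ true → meetsT X ≡ true
  mixed⇒meetsT X e = ∧T₂ {meetsS X} e

  mergeable⇒noS : ∀ X Y → mergeable X Y ≡ true → meetsS X ≡ false
  mergeable⇒noS X Y e = not-true (∧T₁ e)

  mergeable⇒noT : ∀ X Y → mergeable X Y ≡ true → meetsT Y ≡ false
  mergeable⇒noT X Y e = not-true (∧T₁ (∧T₂ {not (meetsS X)} e))

  mergeable⇒Le : ∀ X Y → mergeable X Y ≡ true → Le Y X
  mergeable⇒Le X Y e = leᵇ⇒Le Y X (∧T₂ {not (meetsT Y)} (∧T₂ {not (meetsS X)} e))

  ∈∁S∩ : ∀ X i → i ∈ᵇ (∁ S ∩ X) ≡ (not (i ∈ᵇ S) ∧ i ∈ᵇ X)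
  ∈∁S∩ X i = trans (∈∩ (∁ S) X i) (cong (_∧ i ∈ᵇ X) (∈∁ S i))

  ∩-idem : ∀ (V X : Subset n) → V ∩ (V ∩ X) ≡ V ∩ X
  ∩-idem V X = subset-ext λ i → trans (∈∩ V (V ∩ X) i) (trans (cong (i ∈ᵇ V ∧_) (∈∩ V X i))
    (trans (sym (BP.∧-assoc (i ∈ᵇ V) (i ∈ᵇ V) (i ∈ᵇ X)))
        (trans (cong (_∧ i ∈ᵇ X) (BP.∧-idem (i ∈ᵇ V))) (sym (∈∩ V X i)))))

  S∩∁S∩-empty : ∀ X → Empty (S ∩ (∁ S ∩ X))
  S∩∁S∩-empty X i rewrite ∈∩ S (∁ S ∩ X) i | ∈∁S∩ X i = table (i ∈ᵇ S) (i ∈ᵇ X)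
    where
    table : ∀ s x → (s ∧ (not s ∧ x)) ≡ false
    table true x = refl
    table false x = refl

  ∁S∩S∩-empty : ∀ X → Empty (∁ S ∩ (S ∩ X))
  ∁S∩S∩-empty X i rewrite ∈∩ (∁ S) (S ∩ X) i | ∈∩ S X i | ∈∁ S i = table (i ∈ᵇ S) (i ∈ᵇ X)
    where
    table : ∀ s x → (not s ∧ (s ∧ x)) ≡ false
    table true x = refl
    table false x = refl

  private
    ∩-∪-absorb : ∀ s x y → (s ≡ true → x ≡ false) → (s ∧ (x ∨ y)) ≡ (s ∧ y)
    ∩-∪-absorb true x y h rewrite h refl = refl
    ∩-∪-absorb false x y h = refl

  S∩-∪-noS : ∀ X Y → meetsS X ≡ false → S ∩ (X ∪ Y) ≡ S ∩ Y
  S∩-∪-noS X Y e = subset-ext λ i → trans (∈∩ S (X ∪ Y) i) (trans (cong (i ∈ᵇ S ∧_) (∈∪ X Y i))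
    (trans (∩-∪-absorb (i ∈ᵇ S) (i ∈ᵇ X) (i ∈ᵇ Y) (empty∩⇒∉ʳ S X e i)) (sym (∈∩ S Y i))))

  ∁S∩-∪-noT : ∀ X Y → meetsT Y ≡ false → ∁ S ∩ (X ∪ Y) ≡ ∁ S ∩ X
  ∁S∩-∪-noT X Y e = subset-ext λ i → trans (∈∩ (∁ S) (X ∪ Y) i)
    (trans (cong (i ∈ᵇ ∁ S ∧_) (trans (∈∪ X Y i) (BP.∨-comm (i ∈ᵇ X) (i ∈ᵇ Y))))
      (trans (∩-∪-absorb (i ∈ᵇ ∁ S) (i ∈ᵇ Y) (i ∈ᵇ X) (empty∩⇒∉ʳ (∁ S) Y e i)) (sym (∈∩ (∁ S) X i))))

  ι-restrict : ∀ V → (∀ X R → restrict (splitLump X R) V ≡ restrict (X ∷ R) V) →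
    (∀ X Y R → mergeable X Y ≡ true → restrict ((X ∪ Y) ∷ R) V ≡ restrict (X ∷ Y ∷ R) V) →
    ∀ H → restrict (ι H) V ≡ restrict H V
  ι-restrict V split-ok merge-ok = ι-elim (λ H → restrict (ι H) V ≡ restrict H V) refl
    (λ X R e → trans (cong (λ Z → restrict Z V) (ι-mixed X R e)) (split-ok X R))
    (λ X e → cong (λ Z → restrict Z V) (ι-last X e))
    (λ X Y R e c → trans (cong (λ Z → restrict Z V) (ι-merge X Y R e c)) (merge-ok X Y R c))
    (λ X Y R e c ih → trans (cong (λ Z → restrict Z V) (ι-skip X Y R e c))
        (restrict-∷-tail X (ι (Y ∷ R)) (Y ∷ R) V ih))

  private
    restrict-∷-empty : ∀ (X : Subset n) R V → Empty (V ∩ X) → restrict (X ∷ R) V ≡ restrict R V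
    restrict-∷-empty X R V e = restrict-drop X R V (emptyᵇ⁺ (V ∩ X) e)

  ι-restrict-S : ∀ H → restrict (ι H) S ≡ restrict H S
  ι-restrict-S = ι-restrict S
    (λ X R → trans (restrict-∷-empty (∁ S ∩ X) ((S ∩ X) ∷ R) S (S∩∁S∩-empty X))
        (restrict-∷-cong (S ∩ X) X R S (∩-idem S X)))
    (λ X Y R c → sym (trans (restrict-∷-empty X (Y ∷ R) S (emptyᵇ⁻ (S ∩ X) (mergeable⇒noS X Y c)))
                   (restrict-∷-cong Y (X ∪ Y) R S (sym (S∩-∪-noS X Y (mergeable⇒noS X Y c))))))

  ι-restrict-∁S : ∀ H → restrict (ι H) (∁ S) ≡ restrict H (∁ S)
  ι-restrict-∁S = ι-restrict (∁ S)
    (λ X R → trans (restrict-∷-tail (∁ S ∩ X) ((S ∩ X) ∷ R) R (∁ S)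
        (restrict-∷-empty (S ∩ X) R (∁ S) (∁S∩S∩-empty X)))
                   (restrict-∷-cong (∁ S ∩ X) X R (∁ S) (∩-idem (∁ S) X)))
    (λ X Y R c → sym (trans (restrict-∷-tail X (Y ∷ R) R (∁ S)
        (restrict-∷-empty Y R (∁ S) (emptyᵇ⁻ (∁ S ∩ Y) (mergeable⇒noT X Y c))))
                   (restrict-∷-cong X (X ∪ Y) R (∁ S) (sym (∁S∩-∪-noT X Y (mergeable⇒noT X Y c))))))

  LengthChange : Comp n → Set
  LengthChange H = (ι H ≡ H) ⊎ (length (ι H) ≡ suc (length H)) ⊎ (suc (length (ι H)) ≡ length H)

  ι-length : ∀ H → LengthChange H
  ι-length = ι-elim LengthChange (inj₁ refl)
    (λ X R e → inj₂ (inj₁ (cong length (ι-mixed X R e))))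
    (λ X e → inj₁ (ι-last X e))
    (λ X Y R e c → inj₂ (inj₂ (cong (suc ∘ length) (ι-merge X Y R e c))))
    skip
    where
    skip : ∀ X Y R → mixed X ≡ false → mergeable X Y ≡ false → LengthChange (Y ∷ R) → LengthChange (X ∷ Y ∷ R)
    skip X Y R e c ih rewrite ι-skip X Y R e c with ih
    ... | inj₁ q = inj₁ (cong (X ∷_) q)
    ... | inj₂ (inj₁ q) = inj₂ (inj₁ (cong suc q))
    ... | inj₂ (inj₂ q) = inj₂ (inj₂ (cong suc q))

  fixed⇒not-mixed : ∀ X R → ι (X ∷ R) ≡ X ∷ R → mixed X ≡ false
  fixed⇒not-mixed X R h = ≢true⇒false λ e →
    NP.1+n≢n (NP.suc-injective (trans (sym (cong length (ι-mixed X R e))) (cong length h)))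

  fixed⇒not-mergeable : ∀ X Y R → ι (X ∷ Y ∷ R) ≡ X ∷ Y ∷ R → mergeable X Y ≡ false
  fixed⇒not-mergeable X Y R h = ≢true⇒false λ c →
    NP.1+n≢n (sym (NP.suc-injective
        (trans (sym (cong length (ι-merge X Y R (fixed⇒not-mixed X (Y ∷ R) h) c))) (cong length h))))

  fixed⇒tail-fixed : ∀ X Y R → ι (X ∷ Y ∷ R) ≡ X ∷ Y ∷ R → ι (Y ∷ R) ≡ Y ∷ R
  fixed⇒tail-fixed X Y R h =
    LP.∷-injectiveʳ (trans (sym (ι-skip X Y R (fixed⇒not-mixed X (Y ∷ R) h) (fixed⇒not-mergeable X Y R h))) h)

  ι-covers : ∀ H j → covers (ι H) j ≡ covers H j
  ι-covers = ι-elim _ (λ j → refl)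
    (λ X R e j → trans (cong (λ Z → covers Z j) (ι-mixed X R e))
       (trans (cong₂ (λ a b → a ∨ (b ∨ covers R j)) (∈∁S∩ X j) (∈∩ S X j)) (halves (j ∈ᵇ S) (j ∈ᵇ X) (covers R j))))
    (λ X e j → cong (λ Z → covers Z j) (ι-last X e))
    (λ X Y R e c j → trans (cong (λ Z → covers Z j) (ι-merge X Y R e c))
       (trans (cong (_∨ covers R j) (∈∪ X Y j)) (BP.∨-assoc (j ∈ᵇ X) (j ∈ᵇ Y) (covers R j))))
    (λ X Y R e c ih j → trans (cong (λ Z → covers Z j) (ι-skip X Y R e c)) (cong (j ∈ᵇ X ∨_) (ih j)))
    where
    halves : ∀ s x c → ((not s ∧ x) ∨ ((s ∧ x) ∨ c)) ≡ (x ∨ c)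
    halves true x c = refl
    halves false true c = refl
    halves false false c = refl

  splitLump-CompOf : ∀ X R → mixed X ≡ true → ∀ (U : Subset n) → CompOf U (X ∷ R) → CompOf U (splitLump X R)
  splitLump-CompOf X R e U (ne , X⊆U , c) =
    nonemptyᵇ⁻ (∁ S ∩ X) (mixed⇒meetsT X e) ,
    (λ i e' → X⊆U i (∧T₂ {i ∈ᵇ ∁ S} (trans (sym (∈∩ (∁ S) X i)) e'))) ,
    nonemptyᵇ⁻ (S ∩ X) (mixed⇒meetsS X e) ,
    (λ i e' → let h = trans (sym (∈∩ S X i)) e' in
       trans (∈─ U (∁ S ∩ X) i) (trans (cong (λ b → i ∈ᵇ U ∧ not b) (∈∁S∩ X i))
         (S-half (i ∈ᵇ U) (i ∈ᵇ S) (i ∈ᵇ X) (∧T₁ h) (∧T₂ {i ∈ᵇ S} h) (X⊆U i (∧T₂ {i ∈ᵇ S} h))))) ,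
    CompOf-cong R (λ i → trans (∈─ U X i) (trans (rest (i ∈ᵇ U) (i ∈ᵇ S) (i ∈ᵇ X))
      (sym (trans (∈─ (U ─ (∁ S ∩ X)) (S ∩ X) i) (cong₂ (λ a b → a ∧ not b)
        (trans (∈─ U (∁ S ∩ X) i) (cong (λ b → i ∈ᵇ U ∧ not b) (∈∁S∩ X i))) (∈∩ S X i)))))) c
    where
    rest : ∀ u s x → (u ∧ not x) ≡ ((u ∧ not (not s ∧ x)) ∧ not (s ∧ x))
    rest true true true = refl
    rest true true false = refl
    rest true false true = refl
    rest true false false = refl
    rest false s x = refl
    S-half : ∀ u s x → s ≡ true → x ≡ true → u ≡ true → (u ∧ not (not s ∧ x)) ≡ true
    S-half u s x refl refl refl = refl

  merge-lumps-CompOf : ∀ X Y R (U : Subset n) → CompOf U (X ∷ Y ∷ R) → CompOf U ((X ∪ Y) ∷ R)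
  merge-lumps-CompOf X Y R U ((i₀ , e₀) , X⊆U , (_ , Y⊆U─X , c)) =
    (i₀ , trans (∈∪ X Y i₀) (∨I₁ e₀)) ,
    (λ i e' → X∪Y⊆U i (trans (sym (∈∪ X Y i)) e')) ,
    CompOf-cong R (λ i → trans (∈─ (U ─ X) Y i) (trans (cong (_∧ not (i ∈ᵇ Y)) (∈─ U X i))
       (trans (rest (i ∈ᵇ U) (i ∈ᵇ X) (i ∈ᵇ Y))
           (sym (trans (∈─ U (X ∪ Y) i) (cong (λ b → i ∈ᵇ U ∧ not b) (∈∪ X Y i))))))) c
    where
    rest : ∀ u x y → ((u ∧ not x) ∧ not y) ≡ (u ∧ not (x ∨ y))
    rest true true y = refl
    rest true false y = refl
    rest false x y = refl
    X∪Y⊆U : ∀ i → (i ∈ᵇ X ∨ i ∈ᵇ Y) ≡ true → i ∈ᵇ U ≡ true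
    X∪Y⊆U i h with ∨E {i ∈ᵇ X} h
    ... | inj₁ ex = X⊆U i ex
    ... | inj₂ ey = ∈─⇒∈ U X i (Y⊆U─X i ey)

  ι-CompOf : ∀ H U → CompOf U H → CompOf U (ι H)
  ι-CompOf = ι-elim (λ H → ∀ U → CompOf U H → CompOf U (ι H)) (λ U c → c)
    (λ X R e U c → subst (CompOf U) (sym (ι-mixed X R e)) (splitLump-CompOf X R e U c))
    (λ X e U c → subst (CompOf U) (sym (ι-last X e)) c)
    (λ X Y R e m U c → subst (CompOf U) (sym (ι-merge X Y R e m)) (merge-lumps-CompOf X Y R U c))
    (λ X Y R e m ih U (ne , X⊆U , c) → subst (CompOf U) (sym (ι-skip X Y R e m)) (ne , X⊆U , ih (U ─ X) c))

  Le-⊆ : ∀ {A A' B B' : Subset n} → Sub A A' → Sub B B' → Le A' B' → Le A B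
  Le-⊆ sa sb h = mkLe λ x y ex ey → le h x y (sa x ex) (sb y ey)

  Le-∪ˡ : ∀ {X Y Z : Subset n} → Le X Z → Le Y Z → Le (X ∪ Y) Z
  Le-∪ˡ {X} {Y} {Z} hx hy = mkLe λ x z ex ez → case-∪ x z (trans (sym (∈∪ X Y x)) ex) ez
    where
    case-∪ : ∀ x z → (x ∈ᵇ X ∨ x ∈ᵇ Y) ≡ true → z ∈ᵇ Z ≡ true → κ x ≤ κ z
    case-∪ x z ex ez with ∨E {x ∈ᵇ X} ex
    ... | inj₁ e = le hx x z e ez
    ... | inj₂ e = le hy x z e ez

  Le-∪ʳ : ∀ {X Y Z : Subset n} → Le Z X → Le Z Y → Le Z (X ∪ Y)
  Le-∪ʳ {X} {Y} {Z} hx hy = mkLe λ z x ez ex → case-∪ z x ez (trans (sym (∈∪ X Y x)) ex)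
    where
    case-∪ : ∀ z x → z ∈ᵇ Z ≡ true → (x ∈ᵇ X ∨ x ∈ᵇ Y) ≡ true → κ z ≤ κ x
    case-∪ z x ez ex with ∨E {x ∈ᵇ X} ex
    ... | inj₁ e = le hx z x ez e
    ... | inj₂ e = le hy z x ez e

  Le-trans : ∀ {X Y Z : Subset n} → Le X Y → Le Y Z → NonEmpty Y → Le X Z
  Le-trans l₁ l₂ (y₀ , e₀) = mkLe λ x z ex ez → NP.≤-trans (le l₁ x y₀ ex e₀) (le l₂ y₀ z e₀ ez)

  ∩-subset : ∀ (V X : Subset n) → Sub (V ∩ X) X
  ∩-subset V X i e = ∧T₂ {i ∈ᵇ V} (trans (sym (∈∩ V X i)) e)

  All-Le-same-cover : ∀ {X : Subset n} L L' → (∀ y → covers L' y ≡ covers L y) → All (Le X) L → All (Le X) L'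
  All-Le-same-cover L L' same h = All.tabulate λ {Y} mY → mkLe λ x y ex ey →
    let (Z , mZ , ez) = covers⁻ L y (trans (sym (same y)) (covers⁺ L' y mY ey)) in le (All.lookup h mZ) x y ex ez

  -- ι preserves refinement of K (a merged pair lies in one block).
  ι-Refines : ∀ H → Refines H → Refines (ι H)
  ι-Refines = ι-elim (λ H → Refines H → Refines (ι H)) (λ r → r)
    (λ X R e r → subst Refines (sym (ι-mixed X R e)) (split-refines X R r))
    (λ X e r → subst Refines (sym (ι-last X e)) r)
    (λ X Y R e m r → subst Refines (sym (ι-merge X Y R e m)) (merge-refines X Y R m r))
    (λ X Y R e m ih (X≤X , X≤YR , YR-refines) → subst Refines (sym (ι-skip X Y R e m))
       (X≤X , All-Le-same-cover (Y ∷ R) (ι (Y ∷ R)) (ι-covers (Y ∷ R)) X≤YR , ih YR-refines))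
    where
    split-refines : ∀ X R → Refines (X ∷ R) → Refines (splitLump X R)
    split-refines X R (X≤X , X≤R , R-refines) =
      Le-⊆ (∩-subset (∁ S) X) (∩-subset (∁ S) X) X≤X ,
      (Le-⊆ (∩-subset (∁ S) X) (∩-subset S X) X≤X ∷ All.map (Le-⊆ (∩-subset (∁ S) X) (λ _ e → e)) X≤R) ,
      Le-⊆ (∩-subset S X) (∩-subset S X) X≤X , All.map (Le-⊆ (∩-subset S X) (λ _ e → e)) X≤R , R-refines
    merge-refines : ∀ X Y R → mergeable X Y ≡ true → Refines (X ∷ Y ∷ R) → Refines ((X ∪ Y) ∷ R)
    merge-refines X Y R m (X≤X , (X≤Y ∷ X≤R) , (Y≤Y , Y≤R , R-refines)) =
      Le-∪ˡ (Le-∪ʳ X≤X X≤Y) (Le-∪ʳ (mergeable⇒Le X Y m) Y≤Y) , All.zipWith (λ (a , b) → Le-∪ˡ a b) (X≤R , Y≤R) ,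
          R-refines

  noS⇒⊆∁S : ∀ X → meetsS X ≡ false → ∀ i → i ∈ᵇ X ≡ true → i ∈ᵇ ∁ S ≡ true
  noS⇒⊆∁S X e i ex = ∉⇒∈∁ S i (empty∩⇒∉ˡ S X e i ex)

  noT⇒⊆S : ∀ X → meetsT X ≡ false → ∀ i → i ∈ᵇ X ≡ true → i ∈ᵇ S ≡ true
  noT⇒⊆S X e i ex = trans (sym (BP.not-involutive _)) (cong not (trans (sym (∈∁ S i)) (empty∩⇒∉ˡ (∁ S) X e i ex)))

  noS⇒meetsT : ∀ X → NonEmpty X → meetsS X ≡ false → meetsT X ≡ true
  noS⇒meetsT X (x₀ , e₀) e = nonemptyᵇ⁺ (∁ S ∩ X) (x₀ , trans (∈∩ (∁ S) X x₀) (∧I (noS⇒⊆∁S X e x₀ e₀) e₀))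

  noT⇒meetsS : ∀ X → NonEmpty X → meetsT X ≡ false → meetsS X ≡ true
  noT⇒meetsS X (x₀ , e₀) e = nonemptyᵇ⁺ (S ∩ X) (x₀ , trans (∈∩ S X x₀) (∧I (noT⇒⊆S X e x₀ e₀) e₀))

  not-mixed-meetsT⇒noS : ∀ X → mixed X ≡ false → meetsT X ≡ true → meetsS X ≡ false
  not-mixed-meetsT⇒noS X e t rewrite t = trans (sym (BP.∧-identityʳ (meetsS X))) e

  splitLump-not-mixed : ∀ X → mixed (∁ S ∩ X) ≡ false
  splitLump-not-mixed X rewrite emptyᵇ⁺ (S ∩ (∁ S ∩ X)) (S∩∁S∩-empty X) = refl

  splitLump-mergeable : ∀ X → Le X X → mergeable (∁ S ∩ X) (S ∩ X) ≡ true
  splitLump-mergeable X X≤X rewrite emptyᵇ⁺ (S ∩ (∁ S ∩ X)) (S∩∁S∩-empty X) | emptyᵇ⁺ (∁ S ∩ (S ∩ X)) (∁S∩S∩-empty X)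
      =
    Le⇒leᵇ (S ∩ X) (∁ S ∩ X) (Le-⊆ (∩-subset S X) (∩-subset (∁ S) X) X≤X)

  splitLump-∪ : ∀ X → (∁ S ∩ X) ∪ (S ∩ X) ≡ X
  splitLump-∪ X = subset-ext λ i → trans (∈∪ (∁ S ∩ X) (S ∩ X) i)
    (trans (cong₂ _∨_ (∈∁S∩ X i) (∈∩ S X i)) (halves (i ∈ᵇ S) (i ∈ᵇ X)))
    where
    halves : ∀ s x → ((not s ∧ x) ∨ (s ∧ x)) ≡ x
    halves true x = refl
    halves false true = refl
    halves false false = refl

  merged-mixed : ∀ X Y → mergeable X Y ≡ true → NonEmpty X → NonEmpty Y → mixed (X ∪ Y) ≡ true
  merged-mixed X Y m nx ny =
    ∧I (trans (cong nonemptyᵇ (S∩-∪-noS X Y (mergeable⇒noS X Y m))) (noT⇒meetsS Y ny (mergeable⇒noT X Y m)))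
       (trans (cong nonemptyᵇ (∁S∩-∪-noT X Y (mergeable⇒noT X Y m))) (noS⇒meetsT X nx (mergeable⇒noS X Y m)))

  merged-∁S-half : ∀ X Y → mergeable X Y ≡ true → ∁ S ∩ (X ∪ Y) ≡ X
  merged-∁S-half X Y m = trans (∁S∩-∪-noT X Y (mergeable⇒noT X Y m)) (∩-⊆ (∁ S) X (noS⇒⊆∁S X (mergeable⇒noS X Y m)))

  merged-S-half : ∀ X Y → mergeable X Y ≡ true → S ∩ (X ∪ Y) ≡ Y
  merged-S-half X Y m = trans (S∩-∪-noS X Y (mergeable⇒noS X Y m)) (∩-⊆ S Y (noT⇒⊆S Y (mergeable⇒noT X Y m)))

  -- If X cannot be merged with Y, it cannot be merged with the head of ι (Y ∷ R)
  -- either: that head is Y, or a pure-T or mixed lump.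
  ι-head-not-mergeable : ∀ X Y R → mergeable X Y ≡ false → NonEmpty Y →
    ∃ λ Z → ∃ λ R' → (ι (Y ∷ R) ≡ Z ∷ R') × (mergeable X Z ≡ false)
  ι-head-not-mergeable X Y R ¬m neY = by-cases R (mixed Y) refl
    where
    T-half-not-mergeable : mixed Y ≡ true → mergeable X (∁ S ∩ Y) ≡ false
    T-half-not-mergeable e rewrite ∩-idem (∁ S) Y | mixed⇒meetsT Y e = BP.∧-zeroʳ _
    by-cases : ∀ R → ∀ b → mixed Y ≡ b → ∃ λ Z → ∃ λ R' → (ι (Y ∷ R) ≡ Z ∷ R') × (mergeable X Z ≡ false)
    by-cases R true e = _ , _ , ι-mixed Y R e , T-half-not-mergeable e
    by-cases [] false e = _ , _ , ι-last Y e , ¬m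
    by-cases (W ∷ R) false e = by-next (mergeable Y W) refl
      where
      by-next : ∀ b → mergeable Y W ≡ b → ∃ λ Z → ∃ λ R' → (ι (Y ∷ W ∷ R) ≡ Z ∷ R') × (mergeable X Z ≡ false)
      by-next true m = _ , _ , ι-merge Y W R e m , merged-not-mergeable
        where
        merged-not-mergeable : mergeable X (Y ∪ W) ≡ false
        merged-not-mergeable rewrite ∁S∩-∪-noT Y W (mergeable⇒noT Y W m) | noS⇒meetsT Y neY (mergeable⇒noS Y W m) =
          BP.∧-zeroʳ _
      by-next false m = _ , _ , ι-skip Y W R e m , ¬m

  ι-involutive : ∀ H → All NonEmpty H → All (λ Z → Le Z Z) H → ι (ι H) ≡ H
  ι-involutive = ι-elim (λ H → All NonEmpty H → All (λ Z → Le Z Z) H → ι (ι H) ≡ H) (λ _ _ → refl)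
    (λ X R e ne X≤X → trans (cong ι (ι-mixed X R e))
       (trans (ι-merge (∁ S ∩ X) (S ∩ X) R (splitLump-not-mixed X) (splitLump-mergeable X (All.head X≤X)))
         (cong (_∷ R) (splitLump-∪ X))))
    (λ X e ne X≤X → trans (cong ι (ι-last X e)) (ι-last X e))
    (λ X Y R e m ne X≤X → trans (cong ι (ι-merge X Y R e m))
       (trans (ι-mixed (X ∪ Y) R (merged-mixed X Y m (All.head ne) (All.head (All.tail ne))))
         (cong₂ (λ A B → A ∷ B ∷ R) (merged-∁S-half X Y m) (merged-S-half X Y m))))
    skip
    where
    skip : ∀ X Y R → mixed X ≡ false → mergeable X Y ≡ false →
      (All NonEmpty (Y ∷ R) → All (λ Z → Le Z Z) (Y ∷ R) → ι (ι (Y ∷ R)) ≡ Y ∷ R) →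
      All NonEmpty (X ∷ Y ∷ R) → All (λ Z → Le Z Z) (X ∷ Y ∷ R) → ι (ι (X ∷ Y ∷ R)) ≡ X ∷ Y ∷ R
    skip X Y R e ¬m ih ne X≤X with ι-head-not-mergeable X Y R ¬m (All.head (All.tail ne))
    ... | Z , R' , eq , ¬m' = trans (cong ι (trans (ι-skip X Y R e ¬m) (cong (X ∷_) eq)))
         (trans (ι-skip X Z R' e ¬m') (cong (X ∷_) (trans (cong ι (sym eq)) (ih (All.tail ne) (All.tail X≤X)))))

  NoInversion : Comp n → Set
  NoInversion H = ∀ x y → x ∈ᵇ S ≡ false → y ∈ᵇ S ≡ true → rel H x y ≡ true → κ y ≤ κ x → ⊥

  fixed⇒fixed-tail : ∀ X R → ι (X ∷ R) ≡ X ∷ R → ι R ≡ R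
  fixed⇒fixed-tail X [] _ = refl
  fixed⇒fixed-tail X (Y ∷ R) h = fixed⇒tail-fixed X Y R h

  -- The next lump Y lies in the block of x.  If Y meets S it is pure S and
  -- mergeable with X, contradicting fixedness; otherwise a point of Y ∖ S
  -- precedes y and the inversion moves one lump down.
  inversion-from-first-lump : ∀ U X R → CompOf U (X ∷ R) → Refines (X ∷ R) → ι (X ∷ R) ≡ X ∷ R → NoInversion R →
    ∀ x y → x ∈ᵇ X ≡ true → x ∈ᵇ S ≡ false → y ∈ᵇ S ≡ true → covers R y ≡ true → κ y ≤ κ x → ⊥
  inversion-from-first-lump U X [] _ _ _ _ x y _ _ _ () _
  inversion-from-first-lump U X (Y ∷ R) (_ , _ , (neY , _ , _)) (X≤X , X≤YR , YR-refines) fixed no-inv-YR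
    x y x∈X x∉S y∈S covers-y κy≤κx = by-S (meetsS Y) refl
    where
    X-pure-T : meetsS X ≡ false
    X-pure-T = not-mixed-meetsT⇒noS X (fixed⇒not-mixed X (Y ∷ R) fixed)
                 (nonemptyᵇ⁺ (∁ S ∩ X) (x , trans (∈∩ (∁ S) X x) (∧I (∉⇒∈∁ S x x∉S) x∈X)))
    Y-in-block : ∀ z → z ∈ᵇ Y ≡ true → κ z ≡ κ x
    Y-in-block z z∈Y = NP.≤-antisym
      (NP.≤-trans (Refines⇒κ-mono (Y ∷ R) YR-refines z y (trans (rel-∷-in Y R z y z∈Y) covers-y)) κy≤κx)
      (le (All.head X≤YR) x z x∈X z∈Y)
    X-in-block : ∀ z → z ∈ᵇ X ≡ true → κ x ≡ κ z
    X-in-block z z∈X = NP.≤-antisym (le X≤X x z x∈X z∈X) (le X≤X z x z∈X x∈X)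
    by-S : ∀ b → meetsS Y ≡ b → ⊥
    by-S true Y-meets-S = false≢true (trans (sym (fixed⇒not-mergeable X Y R fixed)) X-Y-mergeable)
      where
      Y-pure-S : meetsT Y ≡ false
      Y-pure-S = trans (sym (BP.∧-identityˡ (meetsT Y)))
                   (trans (cong (_∧ meetsT Y) (sym Y-meets-S)) (fixed⇒not-mixed Y R (fixed⇒tail-fixed X Y R fixed)))
      X-Y-mergeable : mergeable X Y ≡ true
      X-Y-mergeable rewrite X-pure-T | Y-pure-S =
        Le⇒leᵇ Y X (mkLe λ z z' z∈Y z'∈X → NP.≤-reflexive (trans (Y-in-block z z∈Y) (X-in-block z' z'∈X)))
    by-S false Y-pure-T = no-inv-YR x' y x'∉S y∈S (trans (rel-∷-in Y R x' y x'∈Y) covers-y)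
                            (NP.≤-trans κy≤κx (NP.≤-reflexive (sym (Y-in-block x' x'∈Y))))
      where
      x' = proj₁ neY
      x'∈Y = proj₂ neY
      x'∉S : x' ∈ᵇ S ≡ false
      x'∉S = empty∩⇒∉ˡ S Y Y-pure-T x' x'∈Y

  fixed⇒no-inversion : ∀ U H → CompOf U H → Refines H → ι H ≡ H → NoInversion H
  fixed⇒no-inversion U [] c r h x y _ _ rxy _ = false≢true (trans (sym (uncovered⇒¬rel₁ [] x y refl)) rxy)
  fixed⇒no-inversion U (X ∷ R) c@(_ , _ , cR) r@(_ , _ , R-refines) h x y x∉S y∈S rxy κy≤κx = by-first-lump (x ∈ᵇ X)
      refl
    where
    no-inv-R = fixed⇒no-inversion (U ─ X) R cR R-refines (fixed⇒fixed-tail X R h)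
    by-first-lump : ∀ b → x ∈ᵇ X ≡ b → ⊥
    by-first-lump false x∉X = no-inv-R x y x∉S y∈S (∧T₂ {not (y ∈ᵇ X)} (trans (sym (rel-∷-out X R x y x∉X)) rxy))
        κy≤κx
    by-first-lump true x∈X = inversion-from-first-lump U X R c r h no-inv-R x y x∈X x∉S y∈S covers-y κy≤κx
      where
      y∉X : y ∈ᵇ X ≡ false
      y∉X = empty∩⇒∉ʳ S X (not-mixed-meetsT⇒noS X (fixed⇒not-mixed X R h)
              (nonemptyᵇ⁺ (∁ S ∩ X) (x , trans (∈∩ (∁ S) X x) (∧I (∉⇒∈∁ S x x∉S) x∈X)))) y y∈S
      covers-y : covers R y ≡ true
      covers-y = subst (λ b → (b ∨ covers R y) ≡ true) y∉X (trans (sym (rel-∷-in X R x y x∈X)) rxy)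

  -- Hence a fixed point refining K is determined by its restrictions to S and T:
  -- on pairs inside S or inside T it agrees with them, and across S and T it
  -- follows the blocks of K, with T before S inside a block ruled out.
  fixed-points-agree : ∀ H₁ H₂ → CompOf ⊤ H₁ → CompOf ⊤ H₂ → Refines H₁ → Refines H₂ → ι H₁ ≡ H₁ → ι H₂ ≡ H₂ →
    restrict H₁ S ≡ restrict H₂ S → restrict H₁ (∁ S) ≡ restrict H₂ (∁ S) →
    ∀ i j → rel H₁ i j ≡ true → rel H₂ i j ≡ true
  fixed-points-agree H₁ H₂ c₁ c₂ r₁ r₂ f₁ f₂ eS eT i j rij
    with rel-total H₂ i j (trans (CompOf-covers ⊤ H₂ c₂ i) (∈⊤ i)) (trans (CompOf-covers ⊤ H₂ c₂ j) (∈⊤ j))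
  ... | inj₁ r' = r'
  ... | inj₂ rji = by-sides (i ∈ᵇ S) refl (j ∈ᵇ S) refl
    where
    by-sides : ∀ b → i ∈ᵇ S ≡ b → ∀ b' → j ∈ᵇ S ≡ b' → rel H₂ i j ≡ true
    by-sides true iS true jS = same-restriction H₁ H₂ S i j eS iS jS rij
    by-sides false iS false jS = same-restriction H₁ H₂ (∁ S) i j eT (∉⇒∈∁ S i iS) (∉⇒∈∁ S j jS) rij
    by-sides true iS false jS =
      ⊥-elim (fixed⇒no-inversion ⊤ H₂ c₂ r₂ f₂ j i jS iS rji (Refines⇒κ-mono H₁ r₁ i j rij))
    by-sides false iS true jS =
      ⊥-elim (fixed⇒no-inversion ⊤ H₁ c₁ r₁ f₁ i j iS jS rij (Refines⇒κ-mono H₂ r₂ j i rji))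

  fixed-points-unique : ∀ H₁ H₂ → CompOf ⊤ H₁ → CompOf ⊤ H₂ → Refines H₁ → Refines H₂ → ι H₁ ≡ H₁ → ι H₂ ≡ H₂ →
    restrict H₁ S ≡ restrict H₂ S → restrict H₁ (∁ S) ≡ restrict H₂ (∁ S) → H₁ ≡ H₂
  fixed-points-unique H₁ H₂ c₁ c₂ r₁ r₂ f₁ f₂ eS eT = rel-injective ⊤ H₁ H₂ c₁ c₂ λ i j →
    ⇔⇒≡ (fixed-points-agree H₁ H₂ c₁ c₂ r₁ r₂ f₁ f₂ eS eT i j)
        (fixed-points-agree H₂ H₁ c₂ c₁ r₂ r₁ f₂ f₁ (sym eS) (sym eT) i j)

  mergeK : Comp n → Comp n → Comp n
  mergeK = merge leᵇ

  ¬leᵇ⇒Le : ∀ A B → leᵇ A B ≡ false → Le A A → Le B B → Le B A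
  ¬leᵇ⇒Le A B e A≤A B≤B with all⁻-false _ (allFin n) e
  ... | a , _ , ea with all⁻-false _ (allFin n) ea
  ... | b , _ , eb = mkLe λ b' a' eb' ea' → NP.≤-trans (le B≤B b' b eb' b∈B)
      (NP.≤-trans (NP.<⇒≤ κb<κa) (le A≤A a a' a∈A ea'))
    where
    witness : ∀ x y z → (not (x ∧ y) ∨ z) ≡ false → (x ≡ true) × (y ≡ true) × (z ≡ false)
    witness true true false _ = refl , refl , refl
    w = witness (a ∈ᵇ A) (b ∈ᵇ B) (κ a ≤ᵇ κ b) eb
    a∈A = proj₁ w
    b∈B = proj₁ (proj₂ w)
    κb<κa : κ b < κ a
    κb<κa = NP.≰⇒> (λ h → false≢true (trans (sym (proj₂ (proj₂ w))) (≤⇒≤ᵇtrue h)))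

  mergeK-Refines : ∀ F G → Refines F → Refines G → All NonEmpty F → All NonEmpty G → Refines (mergeK F G)
  mergeK-Refines [] G _ G-refines _ _ = G-refines
  mergeK-Refines (A ∷ F) [] F-refines _ _ _ = F-refines
  mergeK-Refines (A ∷ F) (B ∷ G) AF-refines@(A≤A , A≤F , F-refines) BG-refines@(B≤B , B≤G , G-refines)
    neAF@(neA ∷ neF) neBG@(neB ∷ neG) =
    step (mergeK-Refines F (B ∷ G) F-refines BG-refines neF neBG)
        (mergeK-Refines (A ∷ F) G AF-refines G-refines neAF neG)
    where
    step : Refines (mergeK F (B ∷ G)) → Refines (mergeK (A ∷ F) G) → Refines (mergeK (A ∷ F) (B ∷ G))
    step ih₁ ih₂ with leᵇ A B in e
    ... | true = A≤A , All.tabulate A≤rest , ih₁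
      where
      A≤rest : ∀ {Z} → Z ∈ mergeK F (B ∷ G) → Le A Z
      A≤rest m with merge-member leᵇ F (B ∷ G) m
      ... | inj₁ mZ = All.lookup A≤F mZ
      ... | inj₂ (here refl) = leᵇ⇒Le A B e
      ... | inj₂ (there mZ) = Le-trans (leᵇ⇒Le A B e) (All.lookup B≤G mZ) neB
    ... | false = B≤B , All.tabulate B≤rest , ih₂
      where
      B≤A = ¬leᵇ⇒Le A B e A≤A B≤B
      B≤rest : ∀ {Z} → Z ∈ mergeK (A ∷ F) G → Le B Z
      B≤rest m with merge-member leᵇ (A ∷ F) G m
      ... | inj₁ (here refl) = B≤A
      ... | inj₁ (there mZ) = Le-trans B≤A (All.lookup A≤F mZ) neA
      ... | inj₂ mZ = All.lookup B≤G mZ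

  Stable : Comp n → Set
  Stable [] = Unit
  Stable (X ∷ []) = mixed X ≡ false
  Stable (X ∷ Y ∷ R) = (mixed X ≡ false) × (mergeable X Y ≡ false) × Stable (Y ∷ R)

  Stable⇒fixed : ∀ H → Stable H → ι H ≡ H
  Stable⇒fixed [] _ = refl
  Stable⇒fixed (X ∷ []) s = ι-last X s
  Stable⇒fixed (X ∷ Y ∷ R) (s₁ , s₂ , s₃) = trans (ι-skip X Y R s₁ s₂) (cong (X ∷_) (Stable⇒fixed (Y ∷ R) s₃))

  Stable-∷ : ∀ X M → mixed X ≡ false → (∀ Y R → M ≡ Y ∷ R → mergeable X Y ≡ false) → Stable M → Stable (X ∷ M)
  Stable-∷ X [] e _ _ = e
  Stable-∷ X (Y ∷ R) e h s = e , h Y R refl , s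

  PureS PureT : Subset n → Set
  PureS X = (meetsS X ≡ true) × (meetsT X ≡ false)
  PureT X = (meetsS X ≡ false) × (meetsT X ≡ true)

  PureS⇒not-mixed : ∀ X → PureS X → mixed X ≡ false
  PureS⇒not-mixed X (s , t) rewrite s | t = refl

  PureT⇒not-mixed : ∀ X → PureT X → mixed X ≡ false
  PureT⇒not-mixed X (s , t) rewrite s = refl

  PureS⇒not-mergeable : ∀ X Y → PureS X → mergeable X Y ≡ false
  PureS⇒not-mergeable X Y (s , t) rewrite s = refl

  PureT⇒not-mergeable : ∀ X Y → PureT Y → mergeable X Y ≡ false
  PureT⇒not-mergeable X Y (s , t) rewrite t = BP.∧-zeroʳ _

  Stable-PureS : ∀ F → All PureS F → Stable F
  Stable-PureS [] _ = unit
  Stable-PureS (X ∷ F) (pX ∷ pF) =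
    Stable-∷ X F (PureS⇒not-mixed X pX) (λ Y R _ → PureS⇒not-mergeable X Y pX) (Stable-PureS F pF)

  Stable-PureT : ∀ G → All PureT G → Stable G
  Stable-PureT [] _ = unit
  Stable-PureT (X ∷ G) (pX ∷ pG) =
    Stable-∷ X G (PureT⇒not-mixed X pX) (λ { Y R refl → PureT⇒not-mergeable X Y (All.head pG) }) (Stable-PureT G pG)

  -- The merge of a pure-S list F and a pure-T list G is stable: a T-lump B is
  -- placed before an S-lump A only when A does not lie before B in K.
  mergeK-Stable : ∀ F G → All PureS F → All PureT G → Stable (mergeK F G)
  mergeK-Stable [] G _ pG = Stable-PureT G pG
  mergeK-Stable (A ∷ F) [] pF _ = Stable-PureS (A ∷ F) pF
  mergeK-Stable (A ∷ F) (B ∷ G) pAF@(pA ∷ pF) pBG@(pB ∷ pG) =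
    step (mergeK-Stable F (B ∷ G) pF pBG) (mergeK-Stable (A ∷ F) G pAF pG)
    where
    step : Stable (mergeK F (B ∷ G)) → Stable (mergeK (A ∷ F) G) → Stable (mergeK (A ∷ F) (B ∷ G))
    step ih₁ ih₂ with leᵇ A B in e
    ... | true = Stable-∷ A _ (PureS⇒not-mixed A pA) (λ Y R _ → PureS⇒not-mergeable A Y pA) ih₁
    ... | false = Stable-∷ B _ (PureT⇒not-mixed B pB) B-not-mergeable ih₂
      where
      B-not-mergeable : ∀ Y R → mergeK (A ∷ F) G ≡ Y ∷ R → mergeable B Y ≡ false
      B-not-mergeable Y R eq with merge-head leᵇ A F G Y R eq
      ... | inj₁ refl rewrite e = trans (cong (not (meetsS B) ∧_) (BP.∧-zeroʳ (not (meetsT A)))) (BP.∧-zeroʳ _)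
      ... | inj₂ mY = PureT⇒not-mergeable B Y (All.lookup pG mY)

module Product {c ℓ} (𝕜 : Field₀ c ℓ) where

  open Compositions using (CompOf; CompOf-restrict-⊤; CompOf-nonempty; CompOf-lumps; ∧I; ∧T₁; ∧T₂; false≢true;
    ∈S∪∁S; S∩∁S-empty; ∈∁⇒∉; ∈⇒∉∁; nonemptyᵇ⁺; emptyᵇ⁺; ∩-⊆; ∩-disjoint; Disj; rel-restrict; CompOf-cong; ≢true⇒false)
  open Enumeration using (comps-unique; CompOf⇒∈comps; ∈comps⇒CompOf)
  open Merging using (merge-CompOf; merge-length; merge-restrictˡ; merge-restrictʳ)
  open Quasishuffles
  open FiniteSums 𝕜
  open Hopf 𝕜 renaming (refl to ≈-refl; sym to ≈-sym; trans to ≈-trans)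
  import Algebra.Properties.Ring as RingProperties
  open RingProperties ring using (-‿involutive)
  open import Data.Bool using (Bool; true; false; _∧_; not)
  import Data.Bool.Properties as BP
  open import Data.Nat using (ℕ; zero; suc; _≤_; s≤s)
  import Data.Nat.Properties as NP
  open import Data.Fin.Subset using (Subset; _∩_; ∁; ⊤)
  open import Data.List using (length)
  open import Data.List.Membership.Propositional using (_∈_)
  open import Data.List.Relation.Unary.All as All using (All)
  open import Data.Product using (_×_; _,_)
  open import Data.Sum using (inj₁; inj₂)
  open import Data.Empty using (⊥-elim)
  open import Relation.Nullary.Decidable using (⌊_⌋)
  open import Relation.Binary.PropositionalEquality as P using (_≡_; _≢_)
  open import Relation.Binary.Reasoning.Setoid setoid

  sgn-step : ∀ m k → suc k ≤ m → sgn (m ∸ℕ k) ≈ - sgn (m ∸ℕ suc k)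
  sgn-step (suc m) zero _ = ≈-refl
  sgn-step (suc m) (suc k) (s≤s le) = sgn-step m k le

  module _ {n} (S : Subset n) (F G : Comp n) (cF : CompOf S F) (cG : CompOf (∁ S) G) (K : Comp n) (cK : CompOf ⊤ K)
      where

    K|S K|T : Comp n
    K|S = restrict K S
    K|T = restrict K (∁ S)

    μM-at : ∀ F′ G′ → μM F′ G′ K ≈ ind (rel K ≼ₚ (F′ ∣∣ G′))
    μM-at F′ G′ = ≈-trans (∑-single decComp (comps ⊤) _ K (comps-unique ⊤) (CompOf⇒∈comps ⊤ K cK) others)
      (≈-trans (*-congˡ (ind-true (decComp-refl K))) (*-identityʳ _))
      where
      others : ∀ H → H ∈ comps ⊤ → H ≢ K → ind (rel H ≼ₚ (F′ ∣∣ G′)) * M H K ≈ 0#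
      others H _ H≢K = ≈-trans (*-congˡ (ind-false (decComp-false H K H≢K))) (zeroʳ _)

    -- Left side: only F′ = K|S and G′ = K|T contribute.
    left-side : μ S (C F ⊗ C G) K ≈ C F K|S * C G K|T
    left-side = ≈-trans (∑-cong (comps S) inner)
      (≈-trans (∑-single decComp (comps S) _ K|S (comps-unique S) (CompOf⇒∈comps S K|S cKS) others)
        (≈-trans (*-congˡ (ind-true (decComp-refl K|S))) (*-identityʳ _)))
      where
      cKS : CompOf S K|S
      cKS = CompOf-restrict-⊤ K S cK
      cKT : CompOf (∁ S) K|T
      cKT = CompOf-restrict-⊤ K (∁ S) cK
      μM-via-restrictions : ∀ F′ G′ → CompOf S F′ → CompOf (∁ S) G′ →
        μM F′ G′ K ≈ ind (⌊ decComp K|S F′ ⌋ ∧ ⌊ decComp K|T G′ ⌋)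
      μM-via-restrictions F′ G′ cF′ cG′ = ≈-trans (μM-at F′ G′)
          (reflexive (P.cong ind (quasishuffle≡restrictions S F′ G′ cF′ cG′ K cK)))
      inner : ∀ F′ → F′ ∈ comps S →
        ∑ (comps (∁ S)) (λ G′ → (C F ⊗ C G) F′ G′ * μM F′ G′ K) ≈ (C F F′ * C G K|T) * ind (⌊ decComp K|S F′ ⌋)
      inner F′ mF′ = ≈-trans (∑-single decComp (comps (∁ S)) _ K|T (comps-unique (∁ S)) (CompOf⇒∈comps (∁ S) K|T cKT)
          others′)
        (*-congˡ (≈-trans (μM-via-restrictions F′ K|T cF′ cKT)
          (reflexive (P.cong ind (P.trans (P.cong (⌊ decComp K|S F′ ⌋ ∧_) (decComp-refl K|T)) (BP.∧-identityʳ _))))))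
        where
        cF′ : CompOf S F′
        cF′ = ∈comps⇒CompOf S mF′
        others′ : ∀ G′ → G′ ∈ comps (∁ S) → G′ ≢ K|T → (C F ⊗ C G) F′ G′ * μM F′ G′ K ≈ 0#
        others′ G′ mG′ G′≢ = ≈-trans (*-congˡ (≈-trans (μM-via-restrictions F′ G′ cF′ (∈comps⇒CompOf (∁ S) mG′))
          (ind-false (P.trans (P.cong (⌊ decComp K|S F′ ⌋ ∧_) (decComp-false K|T G′ (λ e → G′≢ (P.sym e))))
              (BP.∧-zeroʳ _)))))
          (zeroʳ _)
      others : ∀ F′ → F′ ∈ comps S → F′ ≢ K|S → (C F F′ * C G K|T) * ind (⌊ decComp K|S F′ ⌋) ≈ 0#
      others F′ _ F′≢ = ≈-trans (*-congˡ (ind-false (decComp-false K|S F′ (λ e → F′≢ (P.sym e))))) (zeroʳ _)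

    open Involution S K cK

    Contributes : Comp n → Bool
    Contributes H = (⌊ decComp (restrict H S) F ⌋ ∧ ⌊ decComp (restrict H (∁ S)) G ⌋) ∧ (rel H ⊆ᵣ rel K)

    sign : Comp n → Carrier
    sign H = sgn ((l F +ℕ l G) ∸ℕ length H)

    right-term : ∀ H → H ∈ comps ⊤ →
      ind (rel H ≼ₚ (F ∣∣ G)) * (sgn ((l F +ℕ l G) ∸ℕ l H) * C H K) ≈ ind (Contributes H) * sign H
    right-term H mH = begin
      ind (rel H ≼ₚ (F ∣∣ G)) * (sign H * C H K)  ≈⟨ *-congˡ (*-comm _ _) ⟩
      ind (rel H ≼ₚ (F ∣∣ G)) * (C H K * sign H)  ≈⟨ ≈-sym (*-assoc _ _ _) ⟩
      (ind (rel H ≼ₚ (F ∣∣ G)) * C H K) * sign H  ≈⟨ *-congʳ (≈-sym (ind-∧ _ _)) ⟩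
      ind ((rel H ≼ₚ (F ∣∣ G)) ∧ (rel H ⊆ᵣ rel K)) * sign H
        ≈⟨ *-congʳ (reflexive (P.cong (λ b → ind (b ∧ (rel H ⊆ᵣ rel K)))
             (quasishuffle≡restrictions S F G cF cG H (∈comps⇒CompOf ⊤ mH)))) ⟩
      ind (Contributes H) * sign H                 ∎

    ConeCondition : Bool
    ConeCondition = (rel F ⊆ᵣ rel K|S) ∧ (rel G ⊆ᵣ rel K|T)

    module Contributor (H : Comp n) (mH : H ∈ comps ⊤) (q : Contributes H ≡ true) where
      cH : CompOf ⊤ H
      cH = ∈comps⇒CompOf ⊤ mH
      H|S≡F : restrict H S ≡ F
      H|S≡F = decComp-true _ _ (∧T₁ (∧T₁ q))
      H|T≡G : restrict H (∁ S) ≡ G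
      H|T≡G = decComp-true _ _ (∧T₂ {⌊ decComp (restrict H S) F ⌋} (∧T₁ q))
      H≤K : (rel H ⊆ᵣ rel K) ≡ true
      H≤K = ∧T₂ {⌊ decComp (restrict H S) F ⌋ ∧ ⌊ decComp (restrict H (∁ S)) G ⌋} q
      H-refines : Refines H
      H-refines = ⊆K⇒Refines ⊤ H cH H≤K

      cone : ConeCondition ≡ true
      cone = ∧I (⊆ᵣ⁺ (rel F) (rel K|S) (restricted S F H|S≡F)) (⊆ᵣ⁺ (rel G) (rel K|T) (restricted (∁ S) G H|T≡G))
        where
        restricted : ∀ V X → restrict H V ≡ X → ∀ i j → rel X i j ≡ true → rel (restrict K V) i j ≡ true
        restricted V X e i j r = restrict-mono H K V (⊆ᵣ⁻ (rel H) (rel K) H≤K) i j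
            (P.subst (λ Z → rel Z i j ≡ true) (P.sym e) r)

      length-bound : length H ≤ l F +ℕ l G
      length-bound = P.subst₂ (λ a b → length H ≤ a +ℕ b) (P.cong length H|S≡F) (P.cong length H|T≡G)
                       (length-≤-restrictions S H (CompOf-nonempty ⊤ H cH))

    open Contributor using (H-refines; length-bound)

    ι-contributes : ∀ H → H ∈ comps ⊤ → Contributes H ≡ true →
      (ι H ∈ comps ⊤) × (Contributes (ι H) ≡ true) × (ι (ι H) ≡ H)
    ι-contributes H mH q =
      CompOf⇒∈comps ⊤ (ι H) (ι-CompOf H ⊤ cH) ,
      ∧I (∧I (P.subst (λ W → ⌊ decComp W F ⌋ ≡ true) (P.sym (ι-restrict-S H)) (∧T₁ (∧T₁ q)))
             (P.subst (λ W → ⌊ decComp W G ⌋ ≡ true) (P.sym (ι-restrict-∁S H))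
                 (∧T₂ {⌊ decComp (restrict H S) F ⌋} (∧T₁ q))))
         (Refines⇒⊆K (ι H) (ι-Refines H (H-refines H mH q))) ,
      ι-involutive H (CompOf-nonempty ⊤ H cH) (Refines-Le-self H (H-refines H mH q))
      where
      cH : CompOf ⊤ H
      cH = ∈comps⇒CompOf ⊤ mH

    ι-reverses-sign : ∀ H → H ∈ comps ⊤ → Contributes H ≡ true → ι H ≢ H → sign (ι H) ≈ - sign H
    ι-reverses-sign H mH q ι≢ with ι-length H
    ... | inj₁ e = ⊥-elim (ι≢ e)
    ... | inj₂ (inj₁ e) = ≈-trans (reflexive (P.cong (λ k → sgn ((l F +ℕ l G) ∸ℕ k)) e))
            (≈-sym (≈-trans (-‿cong (sgn-step (l F +ℕ l G) (length H) longer)) (-‿involutive _)))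
      where
      longer : suc (length H) ≤ l F +ℕ l G
      longer = let (mιH , qιH , _) = ι-contributes H mH q in P.subst (_≤ l F +ℕ l G) e (length-bound (ι H) mιH qιH)
    ... | inj₂ (inj₂ e) = ≈-trans (sgn-step (l F +ℕ l G) (length (ι H)) shorter)
            (-‿cong (reflexive (P.cong (λ k → sgn ((l F +ℕ l G) ∸ℕ k)) e)))
      where
      shorter : suc (length (ι H)) ≤ l F +ℕ l G
      shorter = P.subst (_≤ l F +ℕ l G) (P.sym e) (length-bound H mH q)

    -- Under the cone condition, the merge of F and G along K is the unique
    -- contributing fixed point of ι, and it has sign +1.
    module UnderCone (cone : ConeCondition ≡ true) where
      F-refines : Refines F
      F-refines = κ-mono⇒Refines S F cF λ i j r → rel-K⇒κ≤ i j (∧T₂ {j ∈ᵇ S} (∧T₂ {i ∈ᵇ S}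
        (P.trans (P.sym (rel-restrict K S i j)) (⊆ᵣ⁻ (rel F) (rel K|S) (∧T₁ cone) i j r))))
      G-refines : Refines G
      G-refines = κ-mono⇒Refines (∁ S) G cG λ i j r → rel-K⇒κ≤ i j (∧T₂ {j ∈ᵇ ∁ S} (∧T₂ {i ∈ᵇ ∁ S}
        (P.trans (P.sym (rel-restrict K (∁ S) i j)) (⊆ᵣ⁻ (rel G) (rel K|T) (∧T₂ {rel F ⊆ᵣ rel K|S} cone) i j r))))
      F-disjoint-∁S : All (Disj (∁ S)) F
      F-disjoint-∁S = All.map (λ F⊆S i e → ∈⇒∉∁ S i (F⊆S i e)) (CompOf-lumps S F cF)
      G-disjoint-S : All (Disj S) G
      G-disjoint-S = All.map (λ G⊆∁S i e → ∈∁⇒∉ S i (G⊆∁S i e)) (CompOf-lumps (∁ S) G cG)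
      F-pure : All PureS F
      F-pure = All.tabulate λ {X} mX →
        P.trans (P.cong nonemptyᵇ (∩-⊆ S X (All.lookup (CompOf-lumps S F cF) mX)))
            (nonemptyᵇ⁺ X (All.lookup (CompOf-nonempty S F cF) mX)) ,
        emptyᵇ⁺ (∁ S ∩ X) (∩-disjoint (∁ S) X (All.lookup F-disjoint-∁S mX))
      G-pure : All PureT G
      G-pure = All.tabulate λ {X} mX →
        emptyᵇ⁺ (S ∩ X) (∩-disjoint S X (All.lookup G-disjoint-S mX)) ,
        P.trans (P.cong nonemptyᵇ (∩-⊆ (∁ S) X (All.lookup (CompOf-lumps (∁ S) G cG) mX)))
          (nonemptyᵇ⁺ X (All.lookup (CompOf-nonempty (∁ S) G cG) mX))

      P₀ : Comp n
      P₀ = mergeK F G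
      P₀-CompOf : CompOf ⊤ P₀
      P₀-CompOf = CompOf-cong P₀ (∈S∪∁S S) (merge-CompOf _ S (∁ S) F G cF cG (S∩∁S-empty S))
      P₀|S : restrict P₀ S ≡ F
      P₀|S = merge-restrictˡ _ S F G (CompOf-lumps S F cF) (CompOf-nonempty S F cF) G-disjoint-S
      P₀|T : restrict P₀ (∁ S) ≡ G
      P₀|T = merge-restrictʳ _ (∁ S) F G F-disjoint-∁S (CompOf-lumps (∁ S) G cG) (CompOf-nonempty (∁ S) G cG)
      P₀-refines : Refines P₀
      P₀-refines = mergeK-Refines F G F-refines G-refines (CompOf-nonempty S F cF) (CompOf-nonempty (∁ S) G cG)
      P₀-fixed : ι P₀ ≡ P₀
      P₀-fixed = Stable⇒fixed P₀ (mergeK-Stable F G F-pure G-pure)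
      P₀-contributes : Contributes P₀ ≡ true
      P₀-contributes = ∧I (∧I (decComp-≡ P₀|S) (decComp-≡ P₀|T)) (Refines⇒⊆K P₀ P₀-refines)
      P₀-sign : sign P₀ ≈ 1#
      P₀-sign = reflexive (P.cong sgn
          (P.trans (P.cong ((l F +ℕ l G) ∸ℕ_) (merge-length _ F G)) (NP.n∸n≡0 (l F +ℕ l G))))

      fixed⇒P₀ : ∀ H → H ∈ comps ⊤ → Contributes H ≡ true → ι H ≡ H → H ≡ P₀
      fixed⇒P₀ H mH q fixed = fixed-points-unique H P₀ (∈comps⇒CompOf ⊤ mH) P₀-CompOf (H-refines H mH q) P₀-refines
        fixed P₀-fixed (P.trans (Contributor.H|S≡F H mH q) (P.sym P₀|S))
            (P.trans (Contributor.H|T≡G H mH q) (P.sym P₀|T))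

      sum-under-cone : ∑ (comps ⊤) (λ H → ind (Contributes H) * sign H) ≈ 1#
      sum-under-cone = ≈-trans (sign-reversing-involution decComp (comps ⊤) Contributes ι sign P₀ (comps-unique ⊤)
        ι-contributes fixed⇒P₀ ι-reverses-sign (CompOf⇒∈comps ⊤ P₀ P₀-CompOf) P₀-contributes P₀-fixed) P₀-sign

    right-sum : ∑ (comps ⊤) (λ H → ind (Contributes H) * sign H) ≈ ind ConeCondition
    right-sum with ConeCondition in e
    ... | true = UnderCone.sum-under-cone e
    ... | false = ∑-ind-none (comps ⊤) Contributes sign λ H mH → ≢true⇒false λ q →
                    false≢true (P.trans (P.sym e) (Contributor.cone H mH q))

    product-formula : μ S (C F ⊗ C G) K
      ≈ ∑ (comps ⊤) (λ H → ind (rel H ≼ₚ (F ∣∣ G)) * (sgn ((l F +ℕ l G) ∸ℕ l H) * C H K))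
    product-formula = begin
      μ S (C F ⊗ C G) K                                      ≈⟨ left-side ⟩
      C F K|S * C G K|T                                      ≈⟨ ≈-sym (ind-∧ _ _) ⟩
      ind ConeCondition                                      ≈⟨ ≈-sym right-sum ⟩
      ∑ (comps ⊤) (λ H → ind (Contributes H) * sign H)       ≈⟨ ≈-sym (∑-cong (comps ⊤) right-term) ⟩
      ∑ (comps ⊤) (λ H → ind (rel H ≼ₚ (F ∣∣ G)) * (sgn ((l F +ℕ l G) ∸ℕ l H) * C H K)) ∎

-- The theorem: both formulas, evaluated pointwise.
open Compositions using (isComp⇒CompOf)

mainTheorem1 : ∀ {c ℓ} (𝕜 : Field₀ c ℓ) → let open Hopf 𝕜 in
    (n : ℕ) (S : Subset n) → Nonempty S → Nonempty (∁ S) →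
    ((F G : Comp n) → isComp S F ≡ true → isComp (∁ S) G ≡ true →
      (K : Comp n) → isComp ⊤ K ≡ true →
      μ S (C F ⊗ C G) K
        ≈ ∑ (comps ⊤) (λ H → ind (rel H ≼ₚ (F ∣∣ G)) * (sgn ((l F +ℕ l G) ∸ℕ l H) * C H K)))
    ×
    ((K : Comp n) → isComp ⊤ K ≡ true →
      (F′ G′ : Comp n) → isComp S F′ ≡ true → isComp (∁ S) G′ ≡ true →
      Δ S (C K) F′ G′ ≈ (CatS S K ⊗ CatT S K) F′ G′)
mainTheorem1 𝕜 n S _ _ =
  (λ F G iF iG K iK →
    Product.product-formula 𝕜 S F G (isComp⇒CompOf S F iF) (isComp⇒CompOf (∁ S) G iG) K (isComp⇒CompOf ⊤ K iK)) ,
  (λ K iK F′ G′ iF iG →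
    Coproduct.coproduct-formula 𝕜 S K (isComp⇒CompOf ⊤ K iK) F′ G′
      (isComp⇒CompOf S F′ iF) (isComp⇒CompOf (∁ S) G′ iG))
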